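{- Let $G$ be a connected cubic graph of order $n$ that is bipartite and $T^*$-free. Then $$\gamma_e(G)\leq \frac{5}{12}n+\frac{1}{2}.$$
   Context: All graphs are finite, simple and undirected. A matching $M$ in $G$ is maximal if it is maximal with respect to inclusion among matchings. The edge domination number $\gamma_e(G)$ is the minimum size of a maximal matching in $G$. $T^*$ denotes the tree obtained from the claw $K_{1,3}$ by subdividing exactly two of its edges exactly once each (so $T^*$ has $6$ vertices). A graph is $T^*$-free if it contains no induced subgraph isomorphic to $T^*$. A graph is cubic if every vertex has degree $3$. -}

module Defs where

open import Data.Nat using (ℕ; _+_; _*_; _≤_)
open import Data.Bool using (Bool; true; false; if_then_else_)
open import Data.Fin using (Fin; zero; suc)
open import Data.List using (List; []; _∷_; length; map; concatMap)
open import Data.Nat.ListAction using (sum)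
open import Data.List.Base using (allFin)
open import Data.List.Membership.Propositional using (_∈_)
open import Data.List.Relation.Unary.All using (All)
open import Data.List.Relation.Unary.Unique.Propositional using (Unique)
open import Data.Product using (Σ; _×_; _,_; proj₁; proj₂)
open import Data.Sum using (_⊎_)
open import Function.Definitions using (Injective)
open import Relation.Binary.PropositionalEquality using (_≡_; _≢_)
open import Relation.Binary.Construct.Closure.ReflexiveTransitive using (Star)
open import Relation.Nullary using (¬_)

record Graph (n : ℕ) : Set where
  field
    adj     : Fin n → Fin n → Bool
    symm    : ∀ u v → adj u v ≡ adj v u
    irrefl  : ∀ v → adj v v ≡ false

open Graph public

Adj : ∀ {n} → Graph n → Fin n → Fin n → Set
Adj G u v = adj G u v ≡ true

degree : ∀ {n} → Graph n → Fin n → ℕ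
degree {n} G v = sum (map (λ w → if adj G v w then 1 else 0) (allFin n))

Cubic : ∀ {n} → Graph n → Set
Cubic G = ∀ v → degree G v ≡ 3

Connected : ∀ {n} → Graph n → Set
Connected G = ∀ u v → Star (Adj G) u v

Bipartite : ∀ {n} → Graph n → Set
Bipartite {n} G = Σ (Fin n → Bool) λ c → ∀ u v → Adj G u v → c u ≢ c v

-- T* : claw with centre 0 and leaves 1,2,3, where edges 0-1 and 0-2 are
-- subdivided once:  0-1, 1-4, 0-2, 2-5, 0-3.
TStar-adj : Fin 6 → Fin 6 → Bool
TStar-adj zero (suc zero) = true
TStar-adj zero (suc (suc zero)) = true
TStar-adj zero (suc (suc (suc zero))) = true
TStar-adj (suc zero) zero = true
TStar-adj (suc (suc zero)) zero = true
TStar-adj (suc (suc (suc zero))) zero = true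
TStar-adj (suc zero) (suc (suc (suc (suc zero)))) = true
TStar-adj (suc (suc (suc (suc zero)))) (suc zero) = true
TStar-adj (suc (suc zero)) (suc (suc (suc (suc (suc zero))))) = true
TStar-adj (suc (suc (suc (suc (suc zero))))) (suc (suc zero)) = true
TStar-adj _ _ = false

TStarFree : ∀ {n} → Graph n → Set
TStarFree {n} G =
  ¬ (Σ (Fin 6 → Fin n) λ f → Injective _≡_ _≡_ f × (∀ i j → adj G (f i) (f j) ≡ TStar-adj i j))

endpoints : ∀ {n} → List (Fin n × Fin n) → List (Fin n)
endpoints = concatMap (λ e → proj₁ e ∷ proj₂ e ∷ [])

IsMatching : ∀ {n} → Graph n → List (Fin n × Fin n) → Set
IsMatching G M = All (λ e → Adj G (proj₁ e) (proj₂ e)) M × Unique (endpoints M)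

-- maximal w.r.t. inclusion: every edge of G has an endpoint covered by M
IsMaximalMatching : ∀ {n} → Graph n → List (Fin n × Fin n) → Set
IsMaximalMatching G M =
  IsMatching G M × (∀ u v → Adj G u v → u ∈ endpoints M ⊎ v ∈ endpoints M)

-- γ_e(G) ≤ k  ⇔  G has a maximal matching with at most k edges
-- (γ_e is the minimum size of a maximal matching).
EdgeDomLe : ∀ {n} → Graph n → ℕ → Set
EdgeDomLe {n} G k = Σ (List (Fin n × Fin n)) λ M → IsMaximalMatching G M × length M ≤ k

-- 12 · γ_e(G) ≤ m  ⇔  some maximal matching M has 12·|M| ≤ m
TwelveEdgeDomLe : ∀ {n} → Graph n → ℕ → Set
TwelveEdgeDomLe {n} G m = Σ (List (Fin n × Fin n)) λ M → IsMaximalMatching G M × 12 * length M ≤ m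

module Submission where

-- In a cubic bipartite graph the only possible edges of a copy of T* are
-- forced by the colouring, so T*-freeness becomes a local "chord" property
-- (tstarChord): if N(v) = {a,b,c}, a ~ a₂ and b ~ b₂, then a₂ or b₂ is
-- adjacent to a second neighbour of v.  From this we derive, starting at any
-- vertex, either the cube Q₃ or a pair of twins (equal neighbourhoods); a twin
-- pair either closes up to K₃,₃ or lies in a *block* x–{p,q}–{s,t}–y, where
-- p,q are twins over {x,s,t} and s,t are twins over {p,q,y}.  The exit y of
-- every block is adjacent to the entry of a further block, so iterating gives
-- a cyclic sequence of m pairwise disjoint blocks which, by connectedness,
-- covers G; in particular 6m ≤ n.  Taking alternately the 3 edges xp, qs, ty
-- and the 2 edges ps, qt of consecutive blocks gives a maximal matching with
-- at most (5m+1)/2 edges, hence 12|M| ≤ 30m + 6 ≤ 5n + 6.  For K₃,₃ and Q₃ a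
-- 3-edge maximal matching is exhibited directly.

open import Defs
open import Data.Nat using (ℕ; zero; suc; _+_; _*_; _≤_; _<_; z≤n; s≤s)
open import Data.Nat.Properties
  using (≤-refl; ≤-trans; ≤-pred; n<1+n; n≤1+n; m≤n+m; m≤n⇒m<n∨m≡n; m≤n⇒∃[o]m+o≡n;
         +-comm; +-assoc; +-suc; +-monoˡ-≤; *-monoʳ-≤; module ≤-Reasoning)
open import Data.Nat.Tactic.RingSolver using (solve-∀)
open import Data.Bool using (Bool; true; false; if_then_else_; T; not) renaming (_≟_ to _≟B_)
open import Data.Bool.Properties using (T?; not-involutive; not-¬; ¬-not)
open import Data.Unit using (tt)
open import Data.Empty using (⊥; ⊥-elim)
open import Data.Fin using (Fin; zero; suc; toℕ) renaming (_≟_ to _≟F_)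
open import Data.Fin.Properties using (injective⇒≤; pigeonhole; all?)
open import Data.Product using (Σ; _×_; _,_; proj₁; proj₂)
open import Data.Sum using (_⊎_; inj₁; inj₂)
open import Data.List using (List; []; _∷_; length; map; filter; lookup; _++_)
open import Data.List.Base using (allFin)
open import Data.List.Properties using (length-++; concatMap-++)
open import Data.Nat.ListAction using (sum)
open import Data.List.Membership.Propositional using (_∈_)
open import Data.List.Membership.Propositional.Properties
  using (∈-filter⁺; ∈-filter⁻; ∈-allFin; ∈-lookup; ∈-++⁻; ∈-++⁺ˡ; ∈-++⁺ʳ)
open import Data.List.Relation.Unary.Any using (here; there)
open import Data.List.Relation.Unary.All using (All; []; _∷_)
import Data.List.Relation.Unary.All as All
import Data.List.Relation.Unary.All.Properties as AllProps
open import Data.List.Relation.Unary.AllPairs using ([]; _∷_)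
open import Data.List.Relation.Unary.Unique.Propositional using (Unique)
open import Data.List.Relation.Unary.Unique.Propositional.Properties using (filter⁺; allFin⁺) renaming (++⁺ to Unique-++⁺)
open import Data.List.Relation.Binary.Disjoint.Propositional using (Disjoint)
open import Relation.Binary.Construct.Closure.ReflexiveTransitive using (Star; ε; _◅_)
open import Relation.Binary.PropositionalEquality
  using (_≡_; _≢_; refl; sym; trans; cong; cong₂; subst; subst₂; ≢-sym; module ≡-Reasoning)
open import Relation.Nullary using (¬_; yes; no; Dec)
open import Relation.Nullary.Decidable using (toWitness; _→-dec_)

-- The degree of a vertex, a 0/1-sum, is the length of the filtered list of
-- its neighbours; this turns `Cubic` into an explicit list of three.
count≡length-filter : ∀ {A : Set} (f : A → Bool) (xs : List A) →
  sum (map (λ w → if f w then 1 else 0) xs) ≡ length (filter (λ w → T? (f w)) xs)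
count≡length-filter f [] = refl
count≡length-filter f (x ∷ xs) with f x
... | true = cong suc (count≡length-filter f xs)
... | false = count≡length-filter f xs

lookup-injective : ∀ {A : Set} (xs : List A) → Unique xs → ∀ {i j} → lookup xs i ≡ lookup xs j → i ≡ j
lookup-injective (x ∷ xs) u {zero} {zero} e = refl
lookup-injective (x ∷ xs) (x∉ ∷ u) {zero} {suc j} e = ⊥-elim (All.lookup x∉ (∈-lookup j) e)
lookup-injective (x ∷ xs) (x∉ ∷ u) {suc i} {zero} e = ⊥-elim (All.lookup x∉ (∈-lookup i) (sym e))
lookup-injective (x ∷ xs) (_ ∷ u) {suc i} {suc j} e = cong suc (lookup-injective xs u e)

-- A duplicate-free list of elements of Fin n has at most n entries; this is
-- how the number of matched vertices is bounded by the order of the graph.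
unique⇒length≤ : ∀ {n} (xs : List (Fin n)) → Unique xs → length xs ≤ n
unique⇒length≤ xs u = injective⇒≤ (lookup-injective xs u)

endpoints-++ : ∀ {n} (xs ys : List (Fin n × Fin n)) → endpoints (xs ++ ys) ≡ endpoints xs ++ endpoints ys
endpoints-++ xs ys = concatMap-++ _ xs ys

length-endpoints : ∀ {n} (xs : List (Fin n × Fin n)) → length (endpoints xs) ≡ length xs + length xs
length-endpoints [] = refl
length-endpoints (e ∷ xs) =
  cong suc (trans (cong suc (length-endpoints xs)) (sym (+-suc (length xs) (length xs))))

-- Parity, used to alternate between the two matchings of consecutive blocks.
isOdd : ℕ → Bool
isOdd zero = false
isOdd (suc k) = not (isOdd k)

-- A graph with six distinct vertices has 12 · 3 ≤ 5n + 6: a 3-edge maximal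
-- matching meets the bound.
sixVertices⇒bound : ∀ {n} (vs : List (Fin n)) → Unique vs → length vs ≡ 6 → 12 * 3 ≤ 5 * n + 6
sixVertices⇒bound {n} vs u six = +-monoˡ-≤ 6 (*-monoʳ-≤ 5 (subst (_≤ n) six (unique⇒length≤ vs u)))

OneOf3 : {A : Set} → A → A → A → A → Set
OneOf3 w a b c = w ≡ a ⊎ w ≡ b ⊎ w ≡ c

fourNotAmongThree : ∀ {A : Set} {w x y z a b c : A} →
  OneOf3 w a b c → OneOf3 x a b c → OneOf3 y a b c → OneOf3 z a b c →
  w ≢ x → w ≢ y → w ≢ z → x ≢ y → x ≢ z → y ≢ z → ⊥
fourNotAmongThree {A} {w} {x} {y} {z} {a} {b} {c} hw hx hy hz wx wy wz xy xz yz = atW hw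
  where
  threeNotAmongTwo : ∀ {x y z p q : A} → x ≡ p ⊎ x ≡ q → y ≡ p ⊎ y ≡ q → z ≡ p ⊎ z ≡ q →
                     x ≢ y → x ≢ z → y ≢ z → ⊥
  threeNotAmongTwo (inj₁ refl) (inj₁ refl) _ xy _ _ = xy refl
  threeNotAmongTwo (inj₂ refl) (inj₂ refl) _ xy _ _ = xy refl
  threeNotAmongTwo (inj₁ refl) (inj₂ refl) (inj₁ refl) _ xz _ = xz refl
  threeNotAmongTwo (inj₁ refl) (inj₂ refl) (inj₂ refl) _ _ yz = yz refl
  threeNotAmongTwo (inj₂ refl) (inj₁ refl) (inj₁ refl) _ _ yz = yz refl
  threeNotAmongTwo (inj₂ refl) (inj₁ refl) (inj₂ refl) _ xz _ = xz refl
  notA : ∀ {u} → OneOf3 u a b c → u ≢ a → u ≡ b ⊎ u ≡ c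
  notA (inj₁ e) ne = ⊥-elim (ne e)
  notA (inj₂ h) ne = h
  notB : ∀ {u} → OneOf3 u a b c → u ≢ b → u ≡ a ⊎ u ≡ c
  notB (inj₁ e) ne = inj₁ e
  notB (inj₂ (inj₁ e)) ne = ⊥-elim (ne e)
  notB (inj₂ (inj₂ e)) ne = inj₂ e
  notC : ∀ {u} → OneOf3 u a b c → u ≢ c → u ≡ a ⊎ u ≡ b
  notC (inj₁ e) ne = inj₁ e
  notC (inj₂ (inj₁ e)) ne = inj₂ e
  notC (inj₂ (inj₂ e)) ne = ⊥-elim (ne e)
  atW : OneOf3 w a b c → ⊥
  atW (inj₁ refl) = threeNotAmongTwo (notA hx (≢-sym wx)) (notA hy (≢-sym wy)) (notA hz (≢-sym wz)) xy xz yz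
  atW (inj₂ (inj₁ refl)) = threeNotAmongTwo (notB hx (≢-sym wx)) (notB hy (≢-sym wy)) (notB hz (≢-sym wz)) xy xz yz
  atW (inj₂ (inj₂ refl)) = threeNotAmongTwo (notC hx (≢-sym wx)) (notC hy (≢-sym wy)) (notC hz (≢-sym wz)) xy xz yz

firstUpTo : {P : ℕ → Set} → (∀ k → Dec (P k)) → ∀ b →
            (Σ ℕ λ m → P m × (∀ k → k < m → ¬ P k)) ⊎ (∀ k → k ≤ b → ¬ P k)
firstUpTo P? zero with P? zero
... | yes p = inj₁ (0 , p , λ k ())
... | no ¬p = inj₂ λ { zero _ → ¬p }
firstUpTo {P} P? (suc b) with firstUpTo P? b
... | inj₁ found = inj₁ found
... | inj₂ none with P? (suc b)
...   | yes p = inj₁ (suc b , p , λ k k<1+b → none k (≤-pred k<1+b))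
...   | no ¬p = inj₂ λ k k≤1+b → below k (m≤n⇒m<n∨m≡n k≤1+b)
  where
  below : ∀ k → k < suc b ⊎ k ≡ suc b → ¬ P k
  below k (inj₁ lt) = none k (≤-pred lt)
  below k (inj₂ refl) = ¬p

leastWitness : {P : ℕ → Set} → (∀ k → Dec (P k)) → Σ ℕ P → Σ ℕ λ m → P m × (∀ k → k < m → ¬ P k)
leastWitness P? (k , pk) with firstUpTo P? k
... | inj₁ found = found
... | inj₂ none = ⊥-elim (none k ≤-refl pk)

spreadsEverywhere : ∀ {n} (G : Graph n) → Connected G → (P : Fin n → Set) →
                    (∀ {u w} → P u → Adj G u w → P w) → ∀ {u} → P u → ∀ w → P w
spreadsEverywhere G conn P step {u} pu w = along (conn u w) pu
  where
  along : ∀ {a b} → Star (Adj G) a b → P a → P b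
  along ε pa = pa
  along (e ◅ walk) pa = along walk (step pa e)

-- The rows of the adjacency matrix of T* are pairwise distinct, so every map
-- Fin 6 → Fin n reproducing T*'s adjacencies is injective.
tstarRowsDistinct : ∀ i j → (∀ k → TStar-adj i k ≡ TStar-adj j k) → i ≡ j
tstarRowsDistinct =
  toWitness {a? = all? λ i → all? λ j → all? (λ k → TStar-adj i k ≟B TStar-adj j k) →-dec i ≟F j} tt

module CubicNeighbourhoods {n : ℕ} (G : Graph n) (cubic : Cubic G) where

  infix 4 _~_
  _~_ : Fin n → Fin n → Set
  u ~ v = Adj G u v

  sym~ : ∀ {u v} → u ~ v → v ~ u
  sym~ {u} {v} e = trans (symm G v u) e

  dec~ : ∀ u v → Dec (u ~ v)
  dec~ u v = adj G u v ≟B true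

  adj⇒≢ : ∀ {u v} → u ~ v → u ≢ v
  adj⇒≢ {u} e refl with trans (sym e) (irrefl G u)
  ... | ()

  record Nbhd (v a b c : Fin n) : Set where
    field
      va : v ~ a
      vb : v ~ b
      vc : v ~ c
      ab : a ≢ b
      ac : a ≢ c
      bc : b ≢ c
      only : ∀ w → v ~ w → OneOf3 w a b c

  nbhdFromList : ∀ v (L : List (Fin n)) → length L ≡ 3 → Unique L → (∀ w → v ~ w → w ∈ L) →
                 (∀ w → w ∈ L → v ~ w) → Σ (Fin n) λ a → Σ (Fin n) λ b → Σ (Fin n) λ c → Nbhd v a b c
  nbhdFromList v (a ∷ b ∷ c ∷ []) refl ((ab ∷ ac ∷ []) ∷ (bc ∷ []) ∷ [] ∷ []) complete sound =
    a , b , c , record { va = sound a (here refl) ; vb = sound b (there (here refl))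
                       ; vc = sound c (there (there (here refl)))
                       ; ab = ab ; ac = ac ; bc = bc ; only = λ w e → fromMember (complete w e) }
    where
    fromMember : ∀ {w} → w ∈ (a ∷ b ∷ c ∷ []) → OneOf3 w a b c
    fromMember (here p) = inj₁ p
    fromMember (there (here p)) = inj₂ (inj₁ p)
    fromMember (there (there (here p))) = inj₂ (inj₂ p)

  -- Every vertex has a neighbourhood of exactly three vertices.  (Kept
  -- abstract: only its specification is ever needed, never its computation.)
  abstract
    nbhd : ∀ v → Σ (Fin n) λ a → Σ (Fin n) λ b → Σ (Fin n) λ c → Nbhd v a b c
    nbhd v = nbhdFromList v (filter isNbr? (allFin n))
      (trans (sym (count≡length-filter (adj G v) (allFin n))) (cubic v))
      (filter⁺ isNbr? {allFin n} (allFin⁺ n))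
      (λ w e → ∈-filter⁺ isNbr? (∈-allFin w) (subst T (sym e) tt))
      (λ w m → T⇒true (proj₂ (∈-filter⁻ isNbr? {xs = allFin n} m)))
      where
      isNbr? : ∀ w → Dec (T (adj G v w))
      isNbr? w = T? (adj G v w)
      T⇒true : ∀ {b} → T b → b ≡ true
      T⇒true {true} _ = refl

  mkNbhd : ∀ {v a b c} → v ~ a → v ~ b → v ~ c → a ≢ b → a ≢ c → b ≢ c → Nbhd v a b c
  mkNbhd {v} {a} {b} {c} va vb vc ab ac bc with nbhd v
  ... | a' , b' , c' , N = record { va = va ; vb = vb ; vc = vc ; ab = ab ; ac = ac ; bc = bc ; only = only }
    where
    only : ∀ w → v ~ w → OneOf3 w a b c
    only w e with w ≟F a | w ≟F b | w ≟F c
    ... | yes p | _ | _ = inj₁ p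
    ... | no _ | yes p | _ = inj₂ (inj₁ p)
    ... | no _ | no _ | yes p = inj₂ (inj₂ p)
    ... | no wa | no wb | no wc =
      ⊥-elim (fourNotAmongThree (Nbhd.only N a va) (Nbhd.only N b vb) (Nbhd.only N c vc) (Nbhd.only N w e)
                                ab ac (≢-sym wa) bc (≢-sym wb) (≢-sym wc))

  swap12 : ∀ {v a b c} → Nbhd v a b c → Nbhd v b a c
  swap12 N = mkNbhd (Nbhd.vb N) (Nbhd.va N) (Nbhd.vc N) (≢-sym (Nbhd.ab N)) (Nbhd.bc N) (Nbhd.ac N)
  swap23 : ∀ {v a b c} → Nbhd v a b c → Nbhd v a c b
  swap23 N = mkNbhd (Nbhd.va N) (Nbhd.vc N) (Nbhd.vb N) (Nbhd.ac N) (Nbhd.ab N) (≢-sym (Nbhd.bc N))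
  rotateL : ∀ {v a b c} → Nbhd v a b c → Nbhd v b c a
  rotateL N = swap23 (swap12 N)
  rotateR : ∀ {v a b c} → Nbhd v a b c → Nbhd v c a b
  rotateR N = swap12 (swap23 N)

  member : ∀ {v a b c w} → Nbhd v a b c → w ~ v → OneOf3 w a b c
  member N e = Nbhd.only N _ (sym~ e)

  notNeighbour : ∀ {v a b c d} → Nbhd v a b c → v ~ d → d ≢ a → d ≢ b → d ≢ c → ⊥
  notNeighbour N e da db dc with Nbhd.only N _ e
  ... | inj₁ p = da p
  ... | inj₂ (inj₁ p) = db p
  ... | inj₂ (inj₂ p) = dc p

  nbhdFrom : ∀ {v u} → v ~ u → Σ (Fin n) λ b → Σ (Fin n) λ c → Nbhd v u b c
  nbhdFrom {v} {u} e with nbhd v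
  ... | a , b , c , N with Nbhd.only N u e
  ... | inj₁ refl = b , c , N
  ... | inj₂ (inj₁ refl) = a , c , swap12 N
  ... | inj₂ (inj₂ refl) = a , b , rotateR N

  thirdNeighbour : ∀ {v u w} → v ~ u → v ~ w → u ≢ w → Σ (Fin n) λ c → Nbhd v u w c
  thirdNeighbour {v} {u} {w} e₁ e₂ u≢w with nbhdFrom e₁
  ... | b , d , N with Nbhd.only N w e₂
  ... | inj₁ p = ⊥-elim (u≢w (sym p))
  ... | inj₂ (inj₁ refl) = d , N
  ... | inj₂ (inj₂ refl) = b , swap23 N

  HasTwin : Fin n → Set
  HasTwin v = Σ (Fin n) λ w → w ≢ v × (∀ u → v ~ u → w ~ u)

  twinOf : ∀ {v w a b c} → Nbhd v a b c → Nbhd w a b c → v ≢ w → HasTwin v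
  twinOf {v} {w} {a} {b} {c} Nv Nw v≢w = w , ≢-sym v≢w , λ u e → listed (Nbhd.only Nv u e)
    where
    listed : ∀ {u} → OneOf3 u a b c → w ~ u
    listed (inj₁ refl) = Nbhd.va Nw
    listed (inj₂ (inj₁ refl)) = Nbhd.vb Nw
    listed (inj₂ (inj₂ refl)) = Nbhd.vc Nw

  hasTwin-resp : ∀ {v w} → v ≡ w → HasTwin v → HasTwin w
  hasTwin-resp refl h = h

module LocalStructure {n : ℕ} (G : Graph n) (cubic : Cubic G) (col : Fin n → Bool)
  (proper : ∀ u v → Adj G u v → col u ≢ col v) (tfree : TStarFree G) where

  open CubicNeighbourhoods G cubic

  colourFlips : ∀ {u w} → u ~ w → col w ≡ not (col u)
  colourFlips {u} {w} e = ¬-not (≢-sym (proper u w e))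

  colourAt2 : ∀ {u w z} → u ~ w → w ~ z → col z ≡ col u
  colourAt2 {u} e₁ e₂ = trans (colourFlips e₂) (trans (cong not (colourFlips e₁)) (not-involutive (col u)))

  sameColour⇒nonAdj : ∀ {u w} → col u ≡ col w → adj G u w ≡ false
  sameColour⇒nonAdj {u} {w} same = ¬-not (λ e → proper u w e same)

  -- Otherwise v, a, b, c, a₂, b₂ induce T*: all further edges would join two
  -- vertices of the same colour.
  tstarChord : ∀ {v a b c a₂ b₂} → Nbhd v a b c → a ~ a₂ → b ~ b₂ → (a₂ ~ b ⊎ a₂ ~ c) ⊎ (b₂ ~ a ⊎ b₂ ~ c)
  tstarChord {v} {a} {b} {c} {a₂} {b₂} N aa₂ bb₂ with dec~ a₂ b | dec~ a₂ c | dec~ b₂ a | dec~ b₂ c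
  ... | yes h | _ | _ | _ = inj₁ (inj₁ h)
  ... | no _ | yes h | _ | _ = inj₁ (inj₂ h)
  ... | no _ | no _ | yes h | _ = inj₂ (inj₁ h)
  ... | no _ | no _ | no _ | yes h = inj₂ (inj₂ h)
  ... | no a₂≁b | no a₂≁c | no b₂≁a | no b₂≁c = ⊥-elim (tfree (f , injective , reproducesTStar))
    where
    open Nbhd N
    f : Fin 6 → Fin n
    f zero = v
    f (suc zero) = a
    f (suc (suc zero)) = b
    f (suc (suc (suc zero))) = c
    f (suc (suc (suc (suc zero)))) = a₂
    f (suc (suc (suc (suc (suc zero))))) = b₂
    ka : col a ≡ not (col v)
    ka = colourFlips va
    kb : col b ≡ not (col v)
    kb = colourFlips vb
    kc : col c ≡ not (col v)
    kc = colourFlips vc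
    ka₂ : col a₂ ≡ col v
    ka₂ = colourAt2 va aa₂
    kb₂ : col b₂ ≡ col v
    kb₂ = colourAt2 vb bb₂
    same : ∀ {u w} → col u ≡ col w → adj G u w ≡ false
    same = sameColour⇒nonAdj
    nonAdj : ∀ {u w} → ¬ (u ~ w) → adj G u w ≡ false
    nonAdj = ¬-not
    reproducesTStar : ∀ i j → adj G (f i) (f j) ≡ TStar-adj i j
    reproducesTStar zero zero = same refl
    reproducesTStar zero (suc zero) = va
    reproducesTStar zero (suc (suc zero)) = vb
    reproducesTStar zero (suc (suc (suc zero))) = vc
    reproducesTStar zero (suc (suc (suc (suc zero)))) = same (sym ka₂)
    reproducesTStar zero (suc (suc (suc (suc (suc zero))))) = same (sym kb₂)
    reproducesTStar (suc zero) zero = sym~ va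
    reproducesTStar (suc zero) (suc zero) = same refl
    reproducesTStar (suc zero) (suc (suc zero)) = same (trans ka (sym kb))
    reproducesTStar (suc zero) (suc (suc (suc zero))) = same (trans ka (sym kc))
    reproducesTStar (suc zero) (suc (suc (suc (suc zero)))) = aa₂
    reproducesTStar (suc zero) (suc (suc (suc (suc (suc zero))))) = nonAdj (λ e → b₂≁a (sym~ e))
    reproducesTStar (suc (suc zero)) zero = sym~ vb
    reproducesTStar (suc (suc zero)) (suc zero) = same (trans kb (sym ka))
    reproducesTStar (suc (suc zero)) (suc (suc zero)) = same refl
    reproducesTStar (suc (suc zero)) (suc (suc (suc zero))) = same (trans kb (sym kc))
    reproducesTStar (suc (suc zero)) (suc (suc (suc (suc zero)))) = nonAdj (λ e → a₂≁b (sym~ e))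
    reproducesTStar (suc (suc zero)) (suc (suc (suc (suc (suc zero))))) = bb₂
    reproducesTStar (suc (suc (suc zero))) zero = sym~ vc
    reproducesTStar (suc (suc (suc zero))) (suc zero) = same (trans kc (sym ka))
    reproducesTStar (suc (suc (suc zero))) (suc (suc zero)) = same (trans kc (sym kb))
    reproducesTStar (suc (suc (suc zero))) (suc (suc (suc zero))) = same refl
    reproducesTStar (suc (suc (suc zero))) (suc (suc (suc (suc zero)))) = nonAdj (λ e → a₂≁c (sym~ e))
    reproducesTStar (suc (suc (suc zero))) (suc (suc (suc (suc (suc zero))))) = nonAdj (λ e → b₂≁c (sym~ e))
    reproducesTStar (suc (suc (suc (suc zero)))) zero = same ka₂
    reproducesTStar (suc (suc (suc (suc zero)))) (suc zero) = sym~ aa₂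
    reproducesTStar (suc (suc (suc (suc zero)))) (suc (suc zero)) = nonAdj a₂≁b
    reproducesTStar (suc (suc (suc (suc zero)))) (suc (suc (suc zero))) = nonAdj a₂≁c
    reproducesTStar (suc (suc (suc (suc zero)))) (suc (suc (suc (suc zero)))) = same refl
    reproducesTStar (suc (suc (suc (suc zero)))) (suc (suc (suc (suc (suc zero))))) = same (trans ka₂ (sym kb₂))
    reproducesTStar (suc (suc (suc (suc (suc zero))))) zero = same kb₂
    reproducesTStar (suc (suc (suc (suc (suc zero))))) (suc zero) = nonAdj b₂≁a
    reproducesTStar (suc (suc (suc (suc (suc zero))))) (suc (suc zero)) = sym~ bb₂
    reproducesTStar (suc (suc (suc (suc (suc zero))))) (suc (suc (suc zero))) = nonAdj b₂≁c
    reproducesTStar (suc (suc (suc (suc (suc zero))))) (suc (suc (suc (suc zero)))) = same (trans kb₂ (sym ka₂))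
    reproducesTStar (suc (suc (suc (suc (suc zero))))) (suc (suc (suc (suc (suc zero))))) = same refl
    injective : ∀ {i j} → f i ≡ f j → i ≡ j
    injective {i} {j} e = tstarRowsDistinct i j λ k →
      trans (sym (reproducesTStar i k)) (trans (cong (λ u → adj G u (f k)) e) (reproducesTStar j k))

  record TwinPair : Set where
    field
      b c v₁ v₂ v₃ : Fin n
      b≢c : b ≢ c
      Nb : Nbhd b v₁ v₂ v₃
      Nc : Nbhd c v₁ v₂ v₃

  -- The complete bipartite graph K₃,₃ (as a subgraph, hence all of G).
  record K33 : Set where
    field
      l₁ l₂ l₃ r₁ r₂ r₃ : Fin n
      L₁ : Nbhd l₁ r₁ r₂ r₃
      L₂ : Nbhd l₂ r₁ r₂ r₃
      L₃ : Nbhd l₃ r₁ r₂ r₃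
      R₁ : Nbhd r₁ l₁ l₂ l₃
      R₂ : Nbhd r₂ l₁ l₂ l₃
      R₃ : Nbhd r₃ l₁ l₂ l₃

  record Cube : Set where
    field
      v a b c α β γ z : Fin n
      Nv : Nbhd v a b c
      Na : Nbhd a v α β
      Nb : Nbhd b v α γ
      Nc : Nbhd c v β γ
      Nα : Nbhd α a b z
      Nβ : Nbhd β a c z
      Nγ : Nbhd γ b c z
      Nz : Nbhd z α β γ

  record Block : Set where
    field
      x p q s t y : Fin n
      xp : x ~ p
      xq : x ~ q
      ps : p ~ s
      pt : p ~ t
      qs : q ~ s
      qt : q ~ t
      sy : s ~ y
      ty : t ~ y
      p≢q : p ≢ q
      s≢t : s ≢ t
      x≁y : ¬ (x ~ y)

  reverse : Block → Block
  reverse W = record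
    { x = y ; p = s ; q = t ; s = p ; t = q ; y = x
    ; xp = sym~ sy ; xq = sym~ ty ; ps = sym~ ps ; pt = sym~ qs ; qs = sym~ pt ; qt = sym~ qt
    ; sy = sym~ xp ; ty = sym~ xq ; p≢q = s≢t ; s≢t = p≢q ; x≁y = λ e → x≁y (sym~ e) }
    where open Block W

  twinsByNbhd : ∀ {a b u w x} → a ≢ b → Nbhd a u w x → b ~ u → b ~ w → b ~ x → TwinPair
  twinsByNbhd {a} {b} {u} {w} {x} a≢b Na bu bw bx = record
    { b = a ; c = b ; v₁ = u ; v₂ = w ; v₃ = x ; b≢c = a≢b ; Nb = Na
    ; Nc = mkNbhd bu bw bx (Nbhd.ab Na) (Nbhd.ac Na) (Nbhd.bc Na) }

  twinsBySharedThird : ∀ {a b u w x x'} → a ≢ b → Nbhd a u w x → Nbhd b u w x' → x' ~ a → TwinPair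
  twinsBySharedThird a≢b Na Nb x'~a with member Na x'~a
  ... | inj₁ p = ⊥-elim (Nbhd.ac Nb (sym p))
  ... | inj₂ (inj₁ p) = ⊥-elim (Nbhd.bc Nb (sym p))
  ... | inj₂ (inj₂ refl) = twinsByNbhd a≢b Na (Nbhd.va Nb) (Nbhd.vb Nb) (Nbhd.vc Nb)

  -- For twins b, c over {v₁,v₂,v₃}, the third neighbours f₁, f₂, f₃ of
  -- v₁, v₂, v₃ are not pairwise distinct: tstarChord at b would give one of
  -- them a fourth neighbour.
  twinThirdsCollide : ∀ {b c v₁ v₂ v₃ f₁ f₂ f₃} → Nbhd b v₁ v₂ v₃ →
                      Nbhd v₁ b c f₁ → Nbhd v₂ b c f₂ → Nbhd v₃ b c f₃ → f₁ ≢ f₂ → f₁ ≢ f₃ → f₂ ≢ f₃ → ⊥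
  twinThirdsCollide Nb F₁ F₂ F₃ f₁₂ f₁₃ f₂₃ with tstarChord Nb (Nbhd.vc F₁) (Nbhd.vc F₂)
  ... | inj₁ (inj₁ e) = notNeighbour F₂ (sym~ e) (≢-sym (Nbhd.ac F₁)) (≢-sym (Nbhd.bc F₁)) f₁₂
  ... | inj₁ (inj₂ e) = notNeighbour F₃ (sym~ e) (≢-sym (Nbhd.ac F₁)) (≢-sym (Nbhd.bc F₁)) f₁₃
  ... | inj₂ (inj₁ e) = notNeighbour F₁ (sym~ e) (≢-sym (Nbhd.ac F₂)) (≢-sym (Nbhd.bc F₂)) (≢-sym f₁₂)
  ... | inj₂ (inj₂ e) = notNeighbour F₃ (sym~ e) (≢-sym (Nbhd.ac F₂)) (≢-sym (Nbhd.bc F₂)) f₂₃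

  blockFromTwins : ∀ {b c v₁ v₂ v₃ f f₃} → b ≢ c → Nbhd b v₁ v₂ v₃ → Nbhd c v₁ v₂ v₃ →
                   Nbhd v₁ b c f → Nbhd v₂ b c f → Nbhd v₃ b c f₃ → f ≢ f₃ → Block
  blockFromTwins {b} {c} {v₁} {v₂} {v₃} {f} b≢c Nb Nc F₁ F₂ F₃ f≢f₃ = record
    { x = f ; p = v₁ ; q = v₂ ; s = b ; t = c ; y = v₃
    ; xp = sym~ (Nbhd.vc F₁) ; xq = sym~ (Nbhd.vc F₂) ; ps = Nbhd.va F₁ ; pt = Nbhd.vb F₁
    ; qs = Nbhd.va F₂ ; qt = Nbhd.vb F₂ ; sy = Nbhd.vc Nb ; ty = Nbhd.vc Nc
    ; p≢q = Nbhd.ab Nb ; s≢t = b≢c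
    ; x≁y = λ e → notNeighbour F₃ (sym~ e) (≢-sym (Nbhd.ac F₁)) (≢-sym (Nbhd.bc F₁)) f≢f₃ }

  -- A twin pair closes up to K₃,₃ (all three third neighbours agree) or
  -- yields a block (exactly two agree); all three distinct is impossible.
  twinsGiveK33OrBlock : TwinPair → K33 ⊎ Block
  twinsGiveK33OrBlock T = byThirds (third (Nbhd.va Nb) (Nbhd.va Nc)) (third (Nbhd.vb Nb) (Nbhd.vb Nc))
                                   (third (Nbhd.vc Nb) (Nbhd.vc Nc))
    where
    open TwinPair T
    third : ∀ {u} → b ~ u → c ~ u → Σ (Fin n) λ f → Nbhd u b c f
    third bu cu = thirdNeighbour (sym~ bu) (sym~ cu) b≢c
    byThirds : (Σ (Fin n) λ f → Nbhd v₁ b c f) → (Σ (Fin n) λ f → Nbhd v₂ b c f) →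
               (Σ (Fin n) λ f → Nbhd v₃ b c f) → K33 ⊎ Block
    byThirds (f₁ , F₁) (f₂ , F₂) (f₃ , F₃) with f₁ ≟F f₂ | f₁ ≟F f₃ | f₂ ≟F f₃
    ... | yes refl | yes refl | _ = inj₁ (record
          { l₁ = b ; l₂ = c ; l₃ = f₁ ; r₁ = v₁ ; r₂ = v₂ ; r₃ = v₃ ; L₁ = Nb ; L₂ = Nc
          ; L₃ = mkNbhd (sym~ (Nbhd.vc F₁)) (sym~ (Nbhd.vc F₂)) (sym~ (Nbhd.vc F₃))
                        (Nbhd.ab Nb) (Nbhd.ac Nb) (Nbhd.bc Nb)
          ; R₁ = F₁ ; R₂ = F₂ ; R₃ = F₃ })
    ... | yes refl | no f₁₃ | _ = inj₂ (blockFromTwins b≢c Nb Nc F₁ F₂ F₃ f₁₃)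
    ... | no f₁₂ | yes refl | _ = inj₂ (blockFromTwins b≢c (swap23 Nb) (swap23 Nc) F₁ F₃ F₂ f₁₂)
    ... | no f₁₂ | no _ | yes refl = inj₂ (blockFromTwins b≢c (rotateL Nb) (rotateL Nc) F₂ F₃ F₁ (≢-sym f₁₂))
    ... | no f₁₂ | no f₁₃ | no f₂₃ = ⊥-elim (twinThirdsCollide Nb F₁ F₂ F₃ f₁₂ f₁₃ f₂₃)

  -- If N(v) = {X,Y,Z} and a neighbour x₁ ≠ v of X is adjacent to neither Y
  -- nor Z, then Y or Z has both its other neighbours adjacent to the other
  -- one, so G has twins.
  twinsFromLoneNeighbour : ∀ {v X Y Z x₁ x₂ y₁ y₂ z₁ z₂} → Nbhd v X Y Z → Nbhd X v x₁ x₂ →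
                           Nbhd Y v y₁ y₂ → Nbhd Z v z₁ z₂ → ¬ (x₁ ~ Y) → ¬ (x₁ ~ Z) → TwinPair
  twinsFromLoneNeighbour {v} {X} {Y} {Z} {x₁} {x₂} {y₁} {y₂} {z₁} {z₂} Nv NX NY NZ x₁≁Y x₁≁Z =
    byChords (dec~ y₁ Z) (dec~ y₂ Z) (dec~ z₁ Y) (dec~ z₂ Y)
    where
    -- A neighbour y' ≠ v of Y missing Z and a neighbour z' ≠ v of Z missing Y
    -- cannot coexist: by tstarChord both are adjacent to X, so both are x₂.
    noDoubleMiss : ∀ {y' z'} → Y ~ y' → y' ≢ v → ¬ (y' ~ Z) → Z ~ z' → z' ≢ v → ¬ (z' ~ Y) → ⊥
    noDoubleMiss {y'} {z'} Yy' y'≢v y'≁Z Zz' z'≢v z'≁Y =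
      bothX₂ (y'~X (tstarChord Nv (Nbhd.vb NX) Yy')) (z'~X (tstarChord (swap23 Nv) (Nbhd.vb NX) Zz'))
      where
      x₁≢y' : x₁ ≢ y'
      x₁≢y' refl = x₁≁Y (sym~ Yy')
      x₁≢z' : x₁ ≢ z'
      x₁≢z' refl = x₁≁Z (sym~ Zz')
      y'~X : (x₁ ~ Y ⊎ x₁ ~ Z) ⊎ (y' ~ X ⊎ y' ~ Z) → y' ~ X
      y'~X (inj₁ (inj₁ e)) = ⊥-elim (x₁≁Y e)
      y'~X (inj₁ (inj₂ e)) = ⊥-elim (x₁≁Z e)
      y'~X (inj₂ (inj₁ e)) = e
      y'~X (inj₂ (inj₂ e)) = ⊥-elim (y'≁Z e)
      z'~X : (x₁ ~ Z ⊎ x₁ ~ Y) ⊎ (z' ~ X ⊎ z' ~ Y) → z' ~ X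
      z'~X (inj₁ (inj₁ e)) = ⊥-elim (x₁≁Z e)
      z'~X (inj₁ (inj₂ e)) = ⊥-elim (x₁≁Y e)
      z'~X (inj₂ (inj₁ e)) = e
      z'~X (inj₂ (inj₂ e)) = ⊥-elim (z'≁Y e)
      bothX₂ : y' ~ X → z' ~ X → ⊥
      bothX₂ e₁ e₂ with member NX e₁ | member NX e₂
      ... | inj₁ p | _ = y'≢v p
      ... | inj₂ (inj₁ p) | _ = x₁≢y' (sym p)
      ... | _ | inj₁ p = z'≢v p
      ... | _ | inj₂ (inj₁ p) = x₁≢z' (sym p)
      ... | inj₂ (inj₂ refl) | inj₂ (inj₂ refl) = z'≁Y (sym~ Yy')
    twinsYZ : y₁ ~ Z → y₂ ~ Z → TwinPair
    twinsYZ e₁ e₂ = twinsByNbhd (Nbhd.bc Nv) NY (sym~ (Nbhd.vc Nv)) (sym~ e₁) (sym~ e₂)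
    twinsZY : z₁ ~ Y → z₂ ~ Y → TwinPair
    twinsZY e₁ e₂ = twinsByNbhd (≢-sym (Nbhd.bc Nv)) NZ (sym~ (Nbhd.vb Nv)) (sym~ e₁) (sym~ e₂)
    byChords : Dec (y₁ ~ Z) → Dec (y₂ ~ Z) → Dec (z₁ ~ Y) → Dec (z₂ ~ Y) → TwinPair
    byChords (yes e₁) (yes e₂) _ _ = twinsYZ e₁ e₂
    byChords (no _) _ (yes e₁) (yes e₂) = twinsZY e₁ e₂
    byChords (yes _) (no _) (yes e₁) (yes e₂) = twinsZY e₁ e₂
    byChords (no m₁) _ (no n₁) _ =
      ⊥-elim (noDoubleMiss (Nbhd.vb NY) (≢-sym (Nbhd.ab NY)) m₁ (Nbhd.vb NZ) (≢-sym (Nbhd.ab NZ)) n₁)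
    byChords (no m₁) _ (yes _) (no n₂) =
      ⊥-elim (noDoubleMiss (Nbhd.vb NY) (≢-sym (Nbhd.ab NY)) m₁ (Nbhd.vc NZ) (≢-sym (Nbhd.ac NZ)) n₂)
    byChords (yes _) (no m₂) (no n₁) _ =
      ⊥-elim (noDoubleMiss (Nbhd.vc NY) (≢-sym (Nbhd.ac NY)) m₂ (Nbhd.vb NZ) (≢-sym (Nbhd.ab NZ)) n₁)
    byChords (yes _) (no m₂) (yes _) (no n₂) =
      ⊥-elim (noDoubleMiss (Nbhd.vc NY) (≢-sym (Nbhd.ac NY)) m₂ (Nbhd.vc NZ) (≢-sym (Nbhd.ac NZ)) n₂)

  chordOrTwins : ∀ {v X Y Z w w'} → Nbhd v X Y Z → Nbhd X v w w' → (w ~ Y ⊎ w ~ Z) ⊎ TwinPair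
  chordOrTwins {v} {X} {Y} {Z} {w} Nv NX with dec~ w Y | dec~ w Z
  ... | yes e | _ = inj₁ (inj₁ e)
  ... | no _ | yes e = inj₁ (inj₂ e)
  ... | no w≁Y | no w≁Z = inj₂ (twinsFromLoneNeighbour Nv NX (proj₂ (proj₂ (nbhdFrom (sym~ (Nbhd.vb Nv)))))
                                  (proj₂ (proj₂ (nbhdFrom (sym~ (Nbhd.vc Nv))))) w≁Y w≁Z)

  -- Then B_P ~ z, since otherwise tstarChord forces
  -- both neighbours of z other than α to equal B_Q.
  cubeClosing : ∀ {v α P Q z Bp Bq} → Nbhd α P Q z → Nbhd P v α Bp → Nbhd Q v α Bq →
                ¬ (v ~ z) → Bp ≢ Bq → Bp ~ z
  cubeClosing {v} {α} {P} {Q} {z} {Bp} {Bq} Nα NP NQ v≁z Bp≢Bq with dec~ Bp z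
  ... | yes e = e
  ... | no Bp≁z with nbhdFrom (sym~ (Nbhd.vc Nα))
  ... | z₁ , z₂ , Nz =
    ⊥-elim (Nbhd.bc Nz (trans (isBq (Nbhd.vb Nz) (≢-sym (Nbhd.ab Nz))) (sym (isBq (Nbhd.vc Nz) (≢-sym (Nbhd.ac Nz))))))
    where
    isBq : ∀ {z'} → z ~ z' → z' ≢ α → z' ≡ Bq
    isBq {z'} zz' z'≢α with tstarChord (rotateR Nα) zz' (Nbhd.vc NP)
    ... | inj₁ (inj₁ e) with member NP e
    ...   | inj₁ refl = ⊥-elim (v≁z (sym~ zz'))
    ...   | inj₂ (inj₁ p) = ⊥-elim (z'≢α p)
    ...   | inj₂ (inj₂ refl) = ⊥-elim (Bp≁z (sym~ zz'))
    isBq {z'} zz' z'≢α | inj₁ (inj₂ e) with member NQ e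
    ...   | inj₁ refl = ⊥-elim (v≁z (sym~ zz'))
    ...   | inj₂ (inj₁ p) = ⊥-elim (z'≢α p)
    ...   | inj₂ (inj₂ p) = p
    isBq zz' z'≢α | inj₂ (inj₁ e) = ⊥-elim (Bp≁z e)
    isBq zz' z'≢α | inj₂ (inj₂ e) with member NQ e
    ...   | inj₁ p = ⊥-elim (Nbhd.ac NP (sym p))
    ...   | inj₂ (inj₁ p) = ⊥-elim (Nbhd.bc NP (sym p))
    ...   | inj₂ (inj₂ p) = ⊥-elim (Bp≢Bq p)

  assembleCube : ∀ {v a b c α β γ} → Nbhd v a b c → Nbhd a v α β → Nbhd b v α γ → Nbhd c v β γ → Cube
  assembleCube {v} {a} {b} {c} {α} {β} {γ} Nv Na Nb Nc = record
    { v = v ; a = a ; b = b ; c = c ; α = α ; β = β ; γ = γ ; z = z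
    ; Nv = Nv ; Na = Na ; Nb = Nb ; Nc = Nc ; Nα = Nα
    ; Nβ = mkNbhd (sym~ (Nbhd.vc Na)) (sym~ (Nbhd.vb Nc)) β~z (Nbhd.ac Nv) (Nbhd.ac Nα) (≢-sym z≢c)
    ; Nγ = mkNbhd (sym~ (Nbhd.vc Nb)) (sym~ (Nbhd.vc Nc)) γ~z (Nbhd.bc Nv) (Nbhd.bc Nα) (≢-sym z≢c)
    ; Nz = mkNbhd (sym~ (Nbhd.vc Nα)) (sym~ β~z) (sym~ γ~z) (Nbhd.bc Na) (Nbhd.bc Nb) (Nbhd.bc Nc) }
    where
    third : Σ (Fin n) λ z → Nbhd α a b z
    third = thirdNeighbour (sym~ (Nbhd.vb Na)) (sym~ (Nbhd.vb Nb)) (Nbhd.ab Nv)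
    z : Fin n
    z = proj₁ third
    Nα : Nbhd α a b z
    Nα = proj₂ third
    z≢c : z ≢ c
    z≢c e with member Nc (subst (α ~_) e (Nbhd.vc Nα))
    ... | inj₁ p = Nbhd.ab Na (sym p)
    ... | inj₂ (inj₁ p) = Nbhd.bc Na p
    ... | inj₂ (inj₂ p) = Nbhd.bc Nb p
    v≁z : ¬ (v ~ z)
    v≁z e with Nbhd.only Nv z e
    ... | inj₁ p = Nbhd.ac Nα (sym p)
    ... | inj₂ (inj₁ p) = Nbhd.bc Nα (sym p)
    ... | inj₂ (inj₂ p) = z≢c p
    β~z : β ~ z
    β~z = cubeClosing Nα Na Nb v≁z (Nbhd.bc Nc)
    γ~z : γ ~ z
    γ~z = cubeClosing (swap12 Nα) Nb Na v≁z (≢-sym (Nbhd.bc Nc))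

  twinsOrCubeFrom : ∀ {v a b c α β} → Nbhd v a b c → Nbhd a v α β → α ~ b → β ~ c → TwinPair ⊎ Cube
  twinsOrCubeFrom Nv Na α~b β~c with thirdNeighbour (sym~ (Nbhd.vb Nv)) (sym~ α~b) (Nbhd.ab Na)
  ... | _ , Nb with chordOrTwins (swap12 Nv) (swap23 Nb)
  ...   | inj₂ T = inj₁ T
  ...   | inj₁ (inj₁ β'~a) = inj₁ (twinsBySharedThird (Nbhd.ab Nv) Na Nb β'~a)
  ...   | inj₁ (inj₂ _) with thirdNeighbour (sym~ (Nbhd.vc Nv)) (sym~ β~c) (Nbhd.ac Na)
  ...     | _ , Nc with chordOrTwins (rotateR Nv) (swap23 Nc)
  ...       | inj₂ T = inj₁ T
  ...       | inj₁ (inj₁ γ~a) = inj₁ (twinsBySharedThird (Nbhd.ac Nv) (swap23 Na) Nc γ~a)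
  ...       | inj₁ (inj₂ γ~b) with member Nb γ~b
  ...         | inj₁ p = ⊥-elim (Nbhd.ac Nc (sym p))
  ...         | inj₂ (inj₁ refl) = inj₁ (twinsBySharedThird (Nbhd.ac Nv) (swap23 Na) Nc (sym~ (Nbhd.vb Na)))
  ...         | inj₂ (inj₂ refl) = inj₂ (assembleCube Nv Na Nb Nc)

  twinsOrCube : Fin n → TwinPair ⊎ Cube
  twinsOrCube v with nbhd v
  ... | _ , _ , _ , Nv with nbhdFrom (sym~ (Nbhd.va Nv))
  ... | _ , _ , Na with chordOrTwins Nv Na | chordOrTwins Nv (swap23 Na)
  ... | inj₂ T | _ = inj₁ T
  ... | inj₁ _ | inj₂ T = inj₁ T
  ... | inj₁ (inj₁ a₁~b) | inj₁ (inj₁ a₂~b) =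
    inj₁ (twinsByNbhd (Nbhd.ab Nv) Na (sym~ (Nbhd.vb Nv)) (sym~ a₁~b) (sym~ a₂~b))
  ... | inj₁ (inj₂ a₁~c) | inj₁ (inj₂ a₂~c) =
    inj₁ (twinsByNbhd (Nbhd.ac Nv) Na (sym~ (Nbhd.vc Nv)) (sym~ a₁~c) (sym~ a₂~c))
  ... | inj₁ (inj₁ a₁~b) | inj₁ (inj₂ a₂~c) = twinsOrCubeFrom Nv Na a₁~b a₂~c
  ... | inj₁ (inj₂ a₁~c) | inj₁ (inj₁ a₂~b) = twinsOrCubeFrom (swap23 Nv) Na a₁~c a₂~b

  module BlockFacts (W : Block) where
    open Block W

    x≢s : x ≢ s
    x≢s refl = x≁y sy
    x≢t : x ≢ t
    x≢t refl = x≁y ty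
    p≢y : p ≢ y
    p≢y refl = x≁y xp
    q≢y : q ≢ y
    q≢y refl = x≁y xq

    Np : Nbhd p x s t
    Np = mkNbhd (sym~ xp) ps pt x≢s x≢t s≢t
    Nq : Nbhd q x s t
    Nq = mkNbhd (sym~ xq) qs qt x≢s x≢t s≢t
    Ns : Nbhd s p q y
    Ns = mkNbhd (sym~ ps) (sym~ qs) sy p≢q p≢y q≢y
    Nt : Nbhd t p q y
    Nt = mkNbhd (sym~ pt) (sym~ qt) ty p≢q p≢y q≢y

    beforeNbhd : Σ (Fin n) λ b → Nbhd x p q b
    beforeNbhd = thirdNeighbour xp xq p≢q
    before : Fin n
    before = proj₁ beforeNbhd
    Nx : Nbhd x p q before
    Nx = proj₂ beforeNbhd
    afterNbhd : Σ (Fin n) λ a → Nbhd y s t a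
    afterNbhd = thirdNeighbour (sym~ sy) (sym~ ty) s≢t
    after : Fin n
    after = proj₁ afterNbhd
    Ny : Nbhd y s t after
    Ny = proj₂ afterNbhd

    before∉ : OneOf3 before p q y → ⊥
    before∉ (inj₁ e) = Nbhd.ac Nx (sym e)
    before∉ (inj₂ (inj₁ e)) = Nbhd.bc Nx (sym e)
    before∉ (inj₂ (inj₂ refl)) = x≁y (Nbhd.vc Nx)
    after∉ : OneOf3 after x s t → ⊥
    after∉ (inj₁ refl) = x≁y (sym~ (Nbhd.vc Ny))
    after∉ (inj₂ (inj₁ e)) = Nbhd.ac Ny (sym e)
    after∉ (inj₂ (inj₂ e)) = Nbhd.bc Ny (sym e)

    pTwin : HasTwin p
    pTwin = twinOf Np Nq p≢q
    qTwin : HasTwin q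
    qTwin = twinOf Nq Np (≢-sym p≢q)
    sTwin : HasTwin s
    sTwin = twinOf Ns Nt s≢t
    tTwin : HasTwin t
    tTwin = twinOf Nt Ns (≢-sym s≢t)

    xNoTwin : ¬ HasTwin x
    xNoTwin (w , w≢x , w~) with member Np (w~ p xp)
    ... | inj₁ e = w≢x e
    ... | inj₂ (inj₁ refl) = before∉ (member Ns (sym~ (w~ before (Nbhd.vc Nx))))
    ... | inj₂ (inj₂ refl) = before∉ (member Nt (sym~ (w~ before (Nbhd.vc Nx))))

    yNoTwin : ¬ HasTwin y
    yNoTwin (w , w≢y , w~) with member Ns (w~ s (sym~ sy))
    ... | inj₂ (inj₂ e) = w≢y e
    ... | inj₁ refl = after∉ (member Np (sym~ (w~ after (Nbhd.vc Ny))))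
    ... | inj₂ (inj₁ refl) = after∉ (member Nq (sym~ (w~ after (Nbhd.vc Ny))))

    pColour : col p ≡ not (col x)
    pColour = colourFlips xp
    qColour : col q ≡ not (col x)
    qColour = colourFlips xq
    sColour : col s ≡ col x
    sColour = colourAt2 xp ps
    tColour : col t ≡ col x
    tColour = colourAt2 xp pt
    yColour : col y ≡ not (col x)
    yColour = trans (colourFlips sy) (cong not sColour)

    twinlessAtP : ∀ {u} → u ~ p → ¬ HasTwin u → u ≡ x
    twinlessAtP e noTwin with member Np e
    ... | inj₁ r = r
    ... | inj₂ (inj₁ refl) = ⊥-elim (noTwin sTwin)
    ... | inj₂ (inj₂ refl) = ⊥-elim (noTwin tTwin)
    twinlessAtQ : ∀ {u} → u ~ q → ¬ HasTwin u → u ≡ x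
    twinlessAtQ e noTwin with member Nq e
    ... | inj₁ r = r
    ... | inj₂ (inj₁ refl) = ⊥-elim (noTwin sTwin)
    ... | inj₂ (inj₂ refl) = ⊥-elim (noTwin tTwin)
    twinnedAtS : ∀ {u} → u ~ s → HasTwin u → u ≡ p ⊎ u ≡ q
    twinnedAtS e twin with member Ns e
    ... | inj₁ r = inj₁ r
    ... | inj₂ (inj₁ r) = inj₂ r
    ... | inj₂ (inj₂ refl) = ⊥-elim (yNoTwin twin)
    twinnedAtT : ∀ {u} → u ~ t → HasTwin u → u ≡ p ⊎ u ≡ q
    twinnedAtT e twin with member Nt e
    ... | inj₁ r = inj₁ r
    ... | inj₂ (inj₁ r) = inj₂ r
    ... | inj₂ (inj₂ refl) = ⊥-elim (yNoTwin twin)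

    afterFar : ∀ {w} → after ~ w → w ≢ y → ¬ (s ~ w) × ¬ (t ~ w)
    afterFar {w} e w≢y = notVia Ns , notVia Nt
      where
      notVia : ∀ {r} → Nbhd r p q y → ¬ (r ~ w)
      notVia Nr r~w with member Nr (sym~ r~w)
      ... | inj₂ (inj₂ r) = w≢y r
      ... | inj₁ refl = after∉ (member Np e)
      ... | inj₂ (inj₁ refl) = after∉ (member Nq e)

    -- Let N(after) = {y, z₁, z₂}.  Every neighbour w ≠ after of z₁ is adjacent
    -- to z₂ (tstarChord at `after`), so z₁ and z₂ are twins.
    afterTwin : ∀ {z₁ z₂ w₁ w₂} → Nbhd after y z₁ z₂ → Nbhd z₁ after w₁ w₂ → Nbhd z₂ after w₁ w₂
    afterTwin {z₁} {z₂} Nz N₁ = mkNbhd (sym~ (Nbhd.vc Nz)) (toZ₂ (Nbhd.vb N₁) (≢-sym (Nbhd.ab N₁)))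
                                       (toZ₂ (Nbhd.vc N₁) (≢-sym (Nbhd.ac N₁))) (Nbhd.ab N₁) (Nbhd.ac N₁) (Nbhd.bc N₁)
      where
      s≁z₁ : ¬ (s ~ z₁)
      s≁z₁ = proj₁ (afterFar (Nbhd.vb Nz) (≢-sym (Nbhd.ab Nz)))
      t≁z₁ : ¬ (t ~ z₁)
      t≁z₁ = proj₂ (afterFar (Nbhd.vb Nz) (≢-sym (Nbhd.ab Nz)))
      s≁z₂ : ¬ (s ~ z₂)
      s≁z₂ = proj₁ (afterFar (Nbhd.vc Nz) (≢-sym (Nbhd.ac Nz)))
      toZ₂ : ∀ {w} → z₁ ~ w → w ≢ after → z₂ ~ w
      toZ₂ {w} e w≢after with tstarChord Nz (sym~ sy) e
      ... | inj₁ (inj₁ r) = ⊥-elim (s≁z₁ r)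
      ... | inj₁ (inj₂ r) = ⊥-elim (s≁z₂ r)
      ... | inj₂ (inj₂ r) = sym~ r
      ... | inj₂ (inj₁ r) with member Ny r
      ...   | inj₁ refl = ⊥-elim (s≁z₁ (sym~ e))
      ...   | inj₂ (inj₁ refl) = ⊥-elim (t≁z₁ (sym~ e))
      ...   | inj₂ (inj₂ r') = ⊥-elim (w≢after r')

    -- Assembling the block after W from N(after) = {y,z₁,z₂} and
    -- N(z₁) = {after,w₁,w₂}: the third neighbours of w₁, w₂ over {z₁,z₂}
    -- coincide (twinThirdsCollide), giving the block after–{z₁,z₂}–{w₁,w₂}–f.
    nextFrom : ∀ {z₁ z₂ w₁ w₂} → Nbhd after y z₁ z₂ → Nbhd z₁ after w₁ w₂ → Σ Block λ W' → y ~ Block.x W'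
    nextFrom {z₁} {z₂} {w₁} {w₂} Nz N₁ = byThirds (third (Nbhd.vb N₁) (Nbhd.vb N₂)) (third (Nbhd.vc N₁) (Nbhd.vc N₂))
      where
      N₂ : Nbhd z₂ after w₁ w₂
      N₂ = afterTwin Nz N₁
      third : ∀ {w} → z₁ ~ w → z₂ ~ w → Σ (Fin n) λ f → Nbhd w z₁ z₂ f
      third e₁ e₂ = thirdNeighbour (sym~ e₁) (sym~ e₂) (Nbhd.bc Nz)
      -- the third neighbour of w₁ or w₂ is not y, whose neighbours are s, t, after
      thirdNotY : ∀ {w f} → z₁ ~ w → w ≢ after → w ~ f → f ≢ y
      thirdNotY z₁w w≢after wf refl with member Ny wf
      ... | inj₁ refl = proj₁ (afterFar (Nbhd.vb Nz) (≢-sym (Nbhd.ab Nz))) (sym~ z₁w)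
      ... | inj₂ (inj₁ refl) = proj₂ (afterFar (Nbhd.vb Nz) (≢-sym (Nbhd.ab Nz))) (sym~ z₁w)
      ... | inj₂ (inj₂ r) = w≢after r
      f₂≢y : ∀ {f₂} → Nbhd w₁ z₁ z₂ f₂ → f₂ ≢ y
      f₂≢y G₂ = thirdNotY (Nbhd.vb N₁) (≢-sym (Nbhd.ab N₁)) (Nbhd.vc G₂)
      f₃≢y : ∀ {f₃} → Nbhd w₂ z₁ z₂ f₃ → f₃ ≢ y
      f₃≢y G₃ = thirdNotY (Nbhd.vc N₁) (≢-sym (Nbhd.ac N₁)) (Nbhd.vc G₃)
      byThirds : (Σ (Fin n) λ f → Nbhd w₁ z₁ z₂ f) → (Σ (Fin n) λ f → Nbhd w₂ z₁ z₂ f) →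
                 Σ Block λ W' → y ~ Block.x W'
      byThirds (f₂ , G₂) (f₃ , G₃) with f₂ ≟F f₃
      ... | yes refl =
        reverse (blockFromTwins (Nbhd.bc Nz) (rotateL N₁) (rotateL N₂) G₂ G₃ (rotateL Nz) (f₂≢y G₂)) , Nbhd.vc Ny
      ... | no f₂≢f₃ =
        ⊥-elim (twinThirdsCollide N₁ (rotateL Nz) G₂ G₃ (≢-sym (f₂≢y G₂)) (≢-sym (f₃≢y G₃)) f₂≢f₃)

    next : Σ Block λ W' → y ~ Block.x W'
    next with nbhdFrom (sym~ (Nbhd.vc Ny))
    ... | _ , _ , Nz = nextFrom Nz (proj₂ (proj₂ (nbhdFrom (sym~ (Nbhd.vb Nz)))))

  -- Every block is followed by another: its exit is adjacent to the entry of
  -- a further block.  (Abstract, so that the construction is never unfolded.)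
  abstract
    nextBlock : (W : Block) → Σ Block λ W' → Block.y W ~ Block.x W'
    nextBlock = BlockFacts.next

  data Role : Set where
    rx rp rq rs rt ry : Role

  -- The roles p, q, s, t are the ones occupied by a vertex with a twin.
  twinRole : Role → Bool
  twinRole rx = false
  twinRole ry = false
  twinRole _ = true

  innerRole outerRole : Role → Bool
  innerRole rp = true
  innerRole rq = true
  innerRole _ = false
  outerRole rs = true
  outerRole rt = true
  outerRole _ = false

  roleColour : Role → Bool → Bool
  roleColour rx b = b
  roleColour rs b = b
  roleColour rt b = b
  roleColour rp b = not b
  roleColour rq b = not b
  roleColour ry b = not b

  vertexAt : Block → Role → Fin n
  vertexAt W rx = Block.x W
  vertexAt W rp = Block.p W
  vertexAt W rq = Block.q W
  vertexAt W rs = Block.s W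
  vertexAt W rt = Block.t W
  vertexAt W ry = Block.y W

  roleHasTwin : ∀ W r → T (twinRole r) → HasTwin (vertexAt W r)
  roleHasTwin W rp _ = BlockFacts.pTwin W
  roleHasTwin W rq _ = BlockFacts.qTwin W
  roleHasTwin W rs _ = BlockFacts.sTwin W
  roleHasTwin W rt _ = BlockFacts.tTwin W

  roleNoTwin : ∀ W r → T (not (twinRole r)) → ¬ HasTwin (vertexAt W r)
  roleNoTwin W rx _ = BlockFacts.xNoTwin W
  roleNoTwin W ry _ = BlockFacts.yNoTwin W

  twinClash : ∀ V W r r' → vertexAt V r ≡ vertexAt W r' → T (twinRole r) → T (not (twinRole r')) → ⊥
  twinClash V W r r' e twin noTwin = roleNoTwin W r' noTwin (hasTwin-resp e (roleHasTwin V r twin))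

  roleColourAt : ∀ W r → col (vertexAt W r) ≡ roleColour r (col (Block.x W))
  roleColourAt W rx = refl
  roleColourAt W rp = BlockFacts.pColour W
  roleColourAt W rq = BlockFacts.qColour W
  roleColourAt W rs = BlockFacts.sColour W
  roleColourAt W rt = BlockFacts.tColour W
  roleColourAt W ry = BlockFacts.yColour W

  colourClash : ∀ V W r r' → vertexAt V r ≡ vertexAt W r' → col (Block.x V) ≡ col (Block.x W) →
                (∀ b → roleColour r b ≢ roleColour r' b) → ⊥
  colourClash V W r r' e sameEntryColour differ = differ (col (Block.x V)) (begin
    roleColour r (col (Block.x V))   ≡⟨ sym (roleColourAt V r) ⟩
    col (vertexAt V r)               ≡⟨ cong col e ⟩
    col (vertexAt W r')              ≡⟨ roleColourAt W r' ⟩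
    roleColour r' (col (Block.x W))  ≡⟨ cong (roleColour r') (sym sameEntryColour) ⟩
    roleColour r' (col (Block.x V))  ∎)
    where open ≡-Reasoning

  entry~inner : ∀ W r → T (innerRole r) → Block.x W ~ vertexAt W r
  entry~inner W rp _ = Block.xp W
  entry~inner W rq _ = Block.xq W

  innerTwinless : ∀ W r → T (innerRole r) → ∀ {u} → u ~ vertexAt W r → ¬ HasTwin u → u ≡ Block.x W
  innerTwinless W rp _ = BlockFacts.twinlessAtP W
  innerTwinless W rq _ = BlockFacts.twinlessAtQ W

  p~outer : ∀ W r → T (outerRole r) → Block.p W ~ vertexAt W r
  p~outer W rs _ = Block.ps W
  p~outer W rt _ = Block.pt W

  outerTwinned : ∀ W r → T (outerRole r) → ∀ {u} → u ~ vertexAt W r → HasTwin u → u ≡ Block.p W ⊎ u ≡ Block.q W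
  outerTwinned W rs _ = BlockFacts.twinnedAtS W
  outerTwinned W rt _ = BlockFacts.twinnedAtT W

  -- The twinned neighbours of an exit y are s and t: its third neighbour is
  -- the entry of the next block, which has no twin.
  exitTwinned : ∀ W {u} → u ~ Block.y W → HasTwin u → u ≡ Block.s W ⊎ u ≡ Block.t W
  exitTwinned W {u} e twin with member (BlockFacts.Ny W) e
  ... | inj₁ r = inj₁ r
  ... | inj₂ (inj₁ r) = inj₂ r
  ... | inj₂ (inj₂ r) with nextBlock W
  ... | W' , y~x' with member (BlockFacts.Ny W) (sym~ y~x')
  ...   | inj₁ r' = ⊥-elim (BlockFacts.xNoTwin W' (hasTwin-resp (sym r') (BlockFacts.sTwin W)))
  ...   | inj₂ (inj₁ r') = ⊥-elim (BlockFacts.xNoTwin W' (hasTwin-resp (sym r') (BlockFacts.tTwin W)))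
  ...   | inj₂ (inj₂ r') = ⊥-elim (BlockFacts.xNoTwin W' (hasTwin-resp (trans r (sym r')) twin))

  -- Blocks sharing an inner vertex share their entry (its twinless neighbour).
  sameEntryViaInner : ∀ V W r r' → T (innerRole r) → T (innerRole r') → vertexAt V r ≡ vertexAt W r' →
                      Block.x V ≡ Block.x W
  sameEntryViaInner V W r r' inner inner' e =
    innerTwinless W r' inner' (subst (Block.x V ~_) e (entry~inner V r inner)) (BlockFacts.xNoTwin V)

  -- Blocks sharing an outer vertex share an inner vertex (a twinned neighbour).
  sameEntryViaOuter : ∀ V W r r' → T (outerRole r) → T (outerRole r') → vertexAt V r ≡ vertexAt W r' →
                      Block.x V ≡ Block.x W
  sameEntryViaOuter V W r r' outer outer' e
    with outerTwinned W r' outer' (subst (Block.p V ~_) e (p~outer V r outer)) (BlockFacts.pTwin V)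
  ... | inj₁ e' = sameEntryViaInner V W rp rp tt tt e'
  ... | inj₂ e' = sameEntryViaInner V W rp rq tt tt e'

  -- Blocks sharing their exit share an outer vertex.
  sameEntryViaExit : ∀ V W → Block.y V ≡ Block.y W → Block.x V ≡ Block.x W
  sameEntryViaExit V W e with exitTwinned W (subst (Block.s V ~_) e (Block.sy V)) (BlockFacts.sTwin V)
  ... | inj₁ e' = sameEntryViaOuter V W rs rs tt tt e'
  ... | inj₂ e' = sameEntryViaOuter V W rs rt tt tt e'

  -- Two blocks whose entries have the same colour and which share a vertex
  -- have the same entry: twin status and colour pin down the roles, and then
  -- the entry is recovered from the shared vertex.
  sharedVertex⇒sameEntry : ∀ V W r r' → vertexAt V r ≡ vertexAt W r' → col (Block.x V) ≡ col (Block.x W) →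
                           Block.x V ≡ Block.x W
  sharedVertex⇒sameEntry V W rx rx e c = e
  sharedVertex⇒sameEntry V W rx rp e c = ⊥-elim (twinClash W V rp rx (sym e) tt tt)
  sharedVertex⇒sameEntry V W rx rq e c = ⊥-elim (twinClash W V rq rx (sym e) tt tt)
  sharedVertex⇒sameEntry V W rx rs e c = ⊥-elim (twinClash W V rs rx (sym e) tt tt)
  sharedVertex⇒sameEntry V W rx rt e c = ⊥-elim (twinClash W V rt rx (sym e) tt tt)
  sharedVertex⇒sameEntry V W rx ry e c = ⊥-elim (colourClash V W rx ry e c λ _ → not-¬ refl)
  sharedVertex⇒sameEntry V W rp rx e c = ⊥-elim (twinClash V W rp rx e tt tt)
  sharedVertex⇒sameEntry V W rp rp e c = sameEntryViaInner V W rp rp tt tt e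
  sharedVertex⇒sameEntry V W rp rq e c = sameEntryViaInner V W rp rq tt tt e
  sharedVertex⇒sameEntry V W rp rs e c = ⊥-elim (colourClash V W rp rs e c λ _ → ≢-sym (not-¬ refl))
  sharedVertex⇒sameEntry V W rp rt e c = ⊥-elim (colourClash V W rp rt e c λ _ → ≢-sym (not-¬ refl))
  sharedVertex⇒sameEntry V W rp ry e c = ⊥-elim (twinClash V W rp ry e tt tt)
  sharedVertex⇒sameEntry V W rq rx e c = ⊥-elim (twinClash V W rq rx e tt tt)
  sharedVertex⇒sameEntry V W rq rp e c = sameEntryViaInner V W rq rp tt tt e
  sharedVertex⇒sameEntry V W rq rq e c = sameEntryViaInner V W rq rq tt tt e
  sharedVertex⇒sameEntry V W rq rs e c = ⊥-elim (colourClash V W rq rs e c λ _ → ≢-sym (not-¬ refl))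
  sharedVertex⇒sameEntry V W rq rt e c = ⊥-elim (colourClash V W rq rt e c λ _ → ≢-sym (not-¬ refl))
  sharedVertex⇒sameEntry V W rq ry e c = ⊥-elim (twinClash V W rq ry e tt tt)
  sharedVertex⇒sameEntry V W rs rx e c = ⊥-elim (twinClash V W rs rx e tt tt)
  sharedVertex⇒sameEntry V W rs rp e c = ⊥-elim (colourClash V W rs rp e c λ _ → not-¬ refl)
  sharedVertex⇒sameEntry V W rs rq e c = ⊥-elim (colourClash V W rs rq e c λ _ → not-¬ refl)
  sharedVertex⇒sameEntry V W rs rs e c = sameEntryViaOuter V W rs rs tt tt e
  sharedVertex⇒sameEntry V W rs rt e c = sameEntryViaOuter V W rs rt tt tt e
  sharedVertex⇒sameEntry V W rs ry e c = ⊥-elim (twinClash V W rs ry e tt tt)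
  sharedVertex⇒sameEntry V W rt rx e c = ⊥-elim (twinClash V W rt rx e tt tt)
  sharedVertex⇒sameEntry V W rt rp e c = ⊥-elim (colourClash V W rt rp e c λ _ → not-¬ refl)
  sharedVertex⇒sameEntry V W rt rq e c = ⊥-elim (colourClash V W rt rq e c λ _ → not-¬ refl)
  sharedVertex⇒sameEntry V W rt rs e c = sameEntryViaOuter V W rt rs tt tt e
  sharedVertex⇒sameEntry V W rt rt e c = sameEntryViaOuter V W rt rt tt tt e
  sharedVertex⇒sameEntry V W rt ry e c = ⊥-elim (twinClash V W rt ry e tt tt)
  sharedVertex⇒sameEntry V W ry rx e c = ⊥-elim (colourClash V W ry rx e c λ _ → ≢-sym (not-¬ refl))
  sharedVertex⇒sameEntry V W ry rp e c = ⊥-elim (twinClash W V rp ry (sym e) tt tt)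
  sharedVertex⇒sameEntry V W ry rq e c = ⊥-elim (twinClash W V rq ry (sym e) tt tt)
  sharedVertex⇒sameEntry V W ry rs e c = ⊥-elim (twinClash W V rs ry (sym e) tt tt)
  sharedVertex⇒sameEntry V W ry rt e c = ⊥-elim (twinClash W V rt ry (sym e) tt tt)
  sharedVertex⇒sameEntry V W ry ry e c = sameEntryViaExit V W e

  -- The two ways of matching the vertices of a block: the long matching
  -- xp, qs, ty covers all six vertices; the short one ps, qt covers p,q,s,t.
  longEdges shortEdges : Block → List (Fin n × Fin n)
  longEdges W = (Block.x W , Block.p W) ∷ (Block.q W , Block.s W) ∷ (Block.t W , Block.y W) ∷ []
  shortEdges W = (Block.p W , Block.s W) ∷ (Block.q W , Block.t W) ∷ []

  edgesOf : Bool → Block → List (Fin n × Fin n)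
  edgesOf true = shortEdges
  edgesOf false = longEdges

  edgesOf-adj : ∀ short W → All (λ e → proj₁ e ~ proj₂ e) (edgesOf short W)
  edgesOf-adj true W = Block.ps W ∷ Block.qt W ∷ []
  edgesOf-adj false W = Block.xp W ∷ Block.qs W ∷ Block.ty W ∷ []

  edgesOf-unique : ∀ short W → Unique (endpoints (edgesOf short W))
  edgesOf-unique true W =
    (adj⇒≢ ps ∷ p≢q ∷ adj⇒≢ pt ∷ []) ∷ (≢-sym (adj⇒≢ qs) ∷ s≢t ∷ []) ∷ (adj⇒≢ qt ∷ []) ∷ [] ∷ []
    where open Block W
  edgesOf-unique false W =
    (adj⇒≢ xp ∷ adj⇒≢ xq ∷ x≢s ∷ x≢t ∷ x≢y ∷ []) ∷ (p≢q ∷ adj⇒≢ ps ∷ adj⇒≢ pt ∷ p≢y ∷ []) ∷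
    (adj⇒≢ qs ∷ adj⇒≢ qt ∷ q≢y ∷ []) ∷ (s≢t ∷ adj⇒≢ sy ∷ []) ∷ (adj⇒≢ ty ∷ []) ∷ [] ∷ []
    where
    open Block W
    open BlockFacts W
    x≢y : x ≢ y
    x≢y e = not-¬ refl (trans (cong col e) yColour)

  edgesOf-vertex : ∀ short W {w} → w ∈ endpoints (edgesOf short W) → Σ Role λ r → vertexAt W r ≡ w
  edgesOf-vertex true W (here e) = rp , sym e
  edgesOf-vertex true W (there (here e)) = rs , sym e
  edgesOf-vertex true W (there (there (here e))) = rq , sym e
  edgesOf-vertex true W (there (there (there (here e)))) = rt , sym e
  edgesOf-vertex false W (here e) = rx , sym e
  edgesOf-vertex false W (there (here e)) = rp , sym e
  edgesOf-vertex false W (there (there (here e))) = rq , sym e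
  edgesOf-vertex false W (there (there (there (here e)))) = rs , sym e
  edgesOf-vertex false W (there (there (there (there (here e))))) = rt , sym e
  edgesOf-vertex false W (there (there (there (there (there (here e)))))) = ry , sym e

  longEdgesCover : ∀ W r → vertexAt W r ∈ endpoints (longEdges W)
  longEdgesCover W rx = here refl
  longEdgesCover W rp = there (here refl)
  longEdgesCover W rq = there (there (here refl))
  longEdgesCover W rs = there (there (there (here refl)))
  longEdgesCover W rt = there (there (there (there (here refl))))
  longEdgesCover W ry = there (there (there (there (there (here refl)))))

  shortEdgesCover : ∀ W r → T (twinRole r) → vertexAt W r ∈ endpoints (shortEdges W)
  shortEdgesCover W rp _ = here refl
  shortEdgesCover W rs _ = there (here refl)
  shortEdgesCover W rq _ = there (there (here refl))
  shortEdgesCover W rt _ = there (there (there (here refl)))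

  module BlockCycle (conn : Connected G) (B₀ : Block) where

    block : ℕ → Block
    block zero = B₀
    block (suc k) = proj₁ (nextBlock (block k))

    entry : ℕ → Fin n
    entry k = Block.x (block k)

    exit~entry : ∀ k → Block.y (block k) ~ entry (suc k)
    exit~entry k = proj₂ (nextBlock (block k))

    entryColour : ∀ k → col (entry k) ≡ col (entry 0)
    entryColour zero = refl
    entryColour (suc k) = begin
      col (entry (suc k))             ≡⟨ colourFlips (exit~entry k) ⟩
      not (col (Block.y (block k)))   ≡⟨ cong not (BlockFacts.yColour (block k)) ⟩
      not (not (col (entry k)))       ≡⟨ not-involutive (col (entry k)) ⟩
      col (entry k)                   ≡⟨ entryColour k ⟩
      col (entry 0)                   ∎
      where open ≡-Reasoning

    -- An entry x has exactly one twinless neighbour (its neighbours p, q have twins).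
    twinlessNbrUnique : ∀ W {u u'} → u ~ Block.x W → ¬ HasTwin u → u' ~ Block.x W → ¬ HasTwin u' → u ≡ u'
    twinlessNbrUnique W e noTwin e' noTwin' = trans (isBefore e noTwin) (sym (isBefore e' noTwin'))
      where
      isBefore : ∀ {u} → u ~ Block.x W → ¬ HasTwin u → u ≡ BlockFacts.before W
      isBefore e noTwin with member (BlockFacts.Nx W) e
      ... | inj₁ refl = ⊥-elim (noTwin (BlockFacts.pTwin W))
      ... | inj₂ (inj₁ refl) = ⊥-elim (noTwin (BlockFacts.qTwin W))
      ... | inj₂ (inj₂ r) = r

    -- Equal entries have equal predecessors: the previous exit is the unique
    -- twinless neighbour of the entry, and a shared exit fixes the block.
    entryPredInjective : ∀ i j → entry (suc i) ≡ entry (suc j) → entry i ≡ entry j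
    entryPredInjective i j e = sameEntryViaExit (block i) (block j)
      (twinlessNbrUnique (block (suc i)) (exit~entry i) (BlockFacts.yNoTwin (block i))
                         (subst (Block.y (block j) ~_) (sym e) (exit~entry j)) (BlockFacts.yNoTwin (block j)))

    -- Hence the sequence of entries is purely periodic.
    period : ∀ i d → entry (suc i + d) ≡ entry i → entry (suc d) ≡ entry 0
    period zero d e = e
    period (suc i) d e = period i d (entryPredInjective (suc (i + d)) i e)

    Returns : ℕ → Set
    Returns k = entry (suc k) ≡ entry 0

    -- Some entry returns to the first one (pigeonhole on n + 1 entries) ...
    someReturn : Σ ℕ Returns
    someReturn with pigeonhole (n<1+n n) (λ k → entry (toℕ k))
    ... | i , j , i<j , same with m≤n⇒∃[o]m+o≡n i<j
    ... | d , i+d≡j = d , period (toℕ i) d (trans (cong entry i+d≡j) (sym same))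

    -- ... and the first return gives the number m of blocks in the cycle.
    -- (Abstract: m is only ever used through this specification.)
    abstract
      firstReturn : Σ ℕ λ k → Returns k × (∀ j → j < k → ¬ Returns j)
      firstReturn = leastWitness (λ k → entry (suc k) ≟F entry 0) someReturn

    m : ℕ
    m = suc (proj₁ firstReturn)

    entry-m : entry m ≡ entry 0
    entry-m = proj₁ (proj₂ firstReturn)

    entriesDistinct : ∀ a b → a < b → b < m → entry a ≢ entry b
    entriesDistinct a b a<b b<m e with m≤n⇒∃[o]m+o≡n a<b
    ... | d , refl = proj₂ (proj₂ firstReturn) d (≤-trans (s≤s (m≤n+m d a)) (≤-pred b<m)) (period a d (sym e))

    InCycle : Fin n → Set
    InCycle w = Σ ℕ λ k → k < m × Σ Role λ r → vertexAt (block k) r ≡ w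

    prevExit : ∀ k → k < m → Σ ℕ λ k' → k' < m × Block.y (block k') ~ entry k
    prevExit zero _ = proj₁ firstReturn , ≤-refl , subst (Block.y (block (proj₁ firstReturn)) ~_) entry-m
                                                         (exit~entry (proj₁ firstReturn))
    prevExit (suc k) k<m = k , ≤-trans (n≤1+n _) k<m , exit~entry k

    nextEntry : ∀ k → k < m → InCycle (entry (suc k))
    nextEntry k k<m with m≤n⇒m<n∨m≡n k<m
    ... | inj₁ lt = suc k , lt , rx , refl
    ... | inj₂ refl = 0 , s≤s z≤n , rx , sym entry-m

    entryNbhd : ∀ k {y'} → y' ~ entry k → ¬ HasTwin y' → ∀ {w} → entry k ~ w →
                OneOf3 w (Block.p (block k)) (Block.q (block k)) y'
    entryNbhd k {y'} e noTwin {w} = Nbhd.only (mkNbhd xp xq (sym~ e) p≢q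
      (λ r → noTwin (hasTwin-resp r (BlockFacts.pTwin (block k))))
      (λ r → noTwin (hasTwin-resp r (BlockFacts.qTwin (block k))))) w
      where open Block (block k)

    exitNbhd : ∀ k {w} → Block.y (block k) ~ w → OneOf3 w (Block.s (block k)) (Block.t (block k)) (entry (suc k))
    exitNbhd k {w} = Nbhd.only (mkNbhd (sym~ sy) (sym~ ty) (exit~entry k) s≢t
      (λ r → BlockFacts.xNoTwin (block (suc k)) (hasTwin-resp r (BlockFacts.sTwin (block k))))
      (λ r → BlockFacts.xNoTwin (block (suc k)) (hasTwin-resp r (BlockFacts.tTwin (block k))))) w
      where open Block (block k)

    inCycle-step : ∀ {u w} → InCycle u → u ~ w → InCycle w
    inCycle-step {w = w} (k , k<m , r , refl) = step r
      where
      W : Block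
      W = block k
      at : ∀ r → w ≡ vertexAt W r → InCycle w
      at r e = k , k<m , r , sym e
      step : ∀ r → vertexAt W r ~ w → InCycle w
      step rp e with member (BlockFacts.Np W) (sym~ e)
      ... | inj₁ q = at rx q
      ... | inj₂ (inj₁ q) = at rs q
      ... | inj₂ (inj₂ q) = at rt q
      step rq e with member (BlockFacts.Nq W) (sym~ e)
      ... | inj₁ q = at rx q
      ... | inj₂ (inj₁ q) = at rs q
      ... | inj₂ (inj₂ q) = at rt q
      step rs e with member (BlockFacts.Ns W) (sym~ e)
      ... | inj₁ q = at rp q
      ... | inj₂ (inj₁ q) = at rq q
      ... | inj₂ (inj₂ q) = at ry q
      step rt e with member (BlockFacts.Nt W) (sym~ e)
      ... | inj₁ q = at rp q
      ... | inj₂ (inj₁ q) = at rq q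
      ... | inj₂ (inj₂ q) = at ry q
      step ry e with exitNbhd k e
      ... | inj₁ q = at rs q
      ... | inj₂ (inj₁ q) = at rt q
      ... | inj₂ (inj₂ refl) = nextEntry k k<m
      step rx e with prevExit k k<m
      ... | k' , k'<m , y~x with entryNbhd k y~x (BlockFacts.yNoTwin (block k')) e
      ...   | inj₁ q = at rp q
      ...   | inj₂ (inj₁ q) = at rq q
      ...   | inj₂ (inj₂ q) = k' , k'<m , ry , sym q

    allInCycle : ∀ w → InCycle w
    allInCycle = spreadsEverywhere G conn InCycle inCycle-step (0 , s≤s z≤n , rx , refl)

    blockEdges : (ℕ → Bool) → ℕ → List (Fin n × Fin n)
    blockEdges short k = edgesOf (short k) (block k)

    edgesBelow : (ℕ → Bool) → ℕ → List (Fin n × Fin n)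
    edgesBelow short zero = []
    edgesBelow short (suc j) = edgesBelow short j ++ blockEdges short j

    coveredBelow : (ℕ → Bool) → ℕ → List (Fin n)
    coveredBelow short j = endpoints (edgesBelow short j)

    edgesBelow-adj : ∀ short j → All (λ e → proj₁ e ~ proj₂ e) (edgesBelow short j)
    edgesBelow-adj short zero = []
    edgesBelow-adj short (suc j) = AllProps.++⁺ (edgesBelow-adj short j) (edgesOf-adj (short j) (block j))

    coveredBelow-block : ∀ short j {w} → w ∈ coveredBelow short j → Σ ℕ λ k → k < j × Σ Role λ r → vertexAt (block k) r ≡ w
    coveredBelow-block short (suc j) {w} h
      with ∈-++⁻ (coveredBelow short j) (subst (w ∈_) (endpoints-++ (edgesBelow short j) (blockEdges short j)) h)
    ... | inj₁ earlier with coveredBelow-block short j earlier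
    ...   | k , k<j , role = k , ≤-trans k<j (n≤1+n _) , role
    coveredBelow-block short (suc j) h | inj₂ this = j , ≤-refl , edgesOf-vertex (short j) (block j) this

    blockCovered : ∀ short k j → k < j → ∀ {w} → w ∈ endpoints (blockEdges short k) → w ∈ coveredBelow short j
    blockCovered short k (suc j) k<1+j {w} h with m≤n⇒m<n∨m≡n k<1+j
    ... | inj₁ k<j = subst (w ∈_) (sym (endpoints-++ (edgesBelow short j) (blockEdges short j)))
                           (∈-++⁺ˡ (blockCovered short k j (≤-pred k<j) h))
    ... | inj₂ refl = subst (w ∈_) (sym (endpoints-++ (edgesBelow short j) (blockEdges short j)))
                            (∈-++⁺ʳ (coveredBelow short j) h)

    -- Distinct blocks of the cycle are vertex-disjoint, so the chosen edges
    -- form a matching.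
    uniqueBelow : ∀ short j → j ≤ m → Unique (coveredBelow short j)
    uniqueBelow short zero _ = []
    uniqueBelow short (suc j) j<m =
      subst Unique (sym (endpoints-++ (edgesBelow short j) (blockEdges short j)))
            (Unique-++⁺ (uniqueBelow short j (≤-trans (n≤1+n j) j<m)) (edgesOf-unique (short j) (block j)) disjoint)
      where
      disjoint : Disjoint (coveredBelow short j) (endpoints (blockEdges short j))
      disjoint (earlier , this) with coveredBelow-block short j earlier | edgesOf-vertex (short j) (block j) this
      ... | k , k<j , r , e₁ | r' , e₂ = entriesDistinct k j k<j j<m
              (sharedVertex⇒sameEntry (block k) (block j) r r' (trans e₁ (sym e₂))
                                      (trans (entryColour k) (sym (entryColour j))))

    -- Matching every block by its long edges covers 6m distinct vertices: 6m ≤ n.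
    allLongLength : ∀ j → length (edgesBelow (λ _ → false) j) ≡ j * 3
    allLongLength zero = refl
    allLongLength (suc j) = trans (length-++ (edgesBelow (λ _ → false) j))
                                  (trans (cong (_+ 3) (allLongLength j)) (+-comm (j * 3) 3))

    sixBlocks≤n : m * 3 + m * 3 ≤ n
    sixBlocks≤n = subst (_≤ n) (trans (length-endpoints (edgesBelow (λ _ → false) m))
                                      (cong₂ _+_ (allLongLength m) (allLongLength m)))
                        (unique⇒length≤ (coveredBelow (λ _ → false) m) (uniqueBelow (λ _ → false) m ≤-refl))

    -- The alternating choice: long edges in even blocks, short ones in odd
    -- blocks.  Two consecutive blocks contribute 5 edges, so 2|M_j| ≤ 5j + 1.
    pairLength : ∀ k → length (blockEdges isOdd k) + length (blockEdges isOdd (suc k)) ≡ 5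
    pairLength k with isOdd k
    ... | true = refl
    ... | false = refl

    twoStepsLength : ∀ j → length (edgesBelow isOdd (suc (suc j))) ≡ length (edgesBelow isOdd j) + 5
    twoStepsLength j = begin
      length ((Mj ++ blockEdges isOdd j) ++ blockEdges isOdd (suc j))
        ≡⟨ length-++ (Mj ++ blockEdges isOdd j) ⟩
      length (Mj ++ blockEdges isOdd j) + length (blockEdges isOdd (suc j))
        ≡⟨ cong (_+ length (blockEdges isOdd (suc j))) (length-++ Mj) ⟩
      (length Mj + length (blockEdges isOdd j)) + length (blockEdges isOdd (suc j))
        ≡⟨ +-assoc (length Mj) _ _ ⟩
      length Mj + (length (blockEdges isOdd j) + length (blockEdges isOdd (suc j)))
        ≡⟨ cong (length Mj +_) (pairLength j) ⟩
      length Mj + 5 ∎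
      where
      open ≡-Reasoning
      Mj : List (Fin n × Fin n)
      Mj = edgesBelow isOdd j

    alternatingLength : ∀ j → length (edgesBelow isOdd j) + length (edgesBelow isOdd j) ≤ j * 5 + 1
    alternatingLength zero = z≤n
    alternatingLength (suc zero) = ≤-refl
    alternatingLength (suc (suc j)) rewrite twoStepsLength j =
      subst₂ _≤_ (sym (double+10 (length (edgesBelow isOdd j)))) (fiveMore j) (+-monoˡ-≤ 10 (alternatingLength j))
      where
      double+10 : ∀ L → (L + 5) + (L + 5) ≡ (L + L) + 10
      double+10 = solve-∀
      fiveMore : ∀ j → (j * 5 + 1) + 10 ≡ suc (suc j) * 5 + 1
      fiveMore = solve-∀

    M : List (Fin n × Fin n)
    M = edgesBelow isOdd m

    matched : List (Fin n)
    matched = endpoints M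

    inM : ∀ {k} → k < m → ∀ {v} → v ∈ endpoints (blockEdges isOdd k) → v ∈ matched
    inM k<m = blockCovered isOdd _ m k<m

    evenCovered : ∀ k → isOdd k ≡ false → ∀ r → vertexAt (block k) r ∈ endpoints (blockEdges isOdd k)
    evenCovered k even r = subst (λ b → vertexAt (block k) r ∈ endpoints (edgesOf b (block k))) (sym even)
                                 (longEdgesCover (block k) r)

    oddCovered : ∀ k → isOdd k ≡ true → ∀ r → T (twinRole r) → vertexAt (block k) r ∈ endpoints (blockEdges isOdd k)
    oddCovered k odd r twin = subst (λ b → vertexAt (block k) r ∈ endpoints (edgesOf b (block k))) (sym odd)
                                    (shortEdgesCover (block k) r twin)

    evenBeforeOdd : ∀ k → isOdd (suc k) ≡ true → isOdd k ≡ false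
    evenBeforeOdd k odd with isOdd k
    ... | false = refl
    ... | true with odd
    ...   | ()

    -- The unmatched entry of an odd block sees only matched vertices: p, q
    -- and the exit of the (even) block before it.
    oddEntryDominated : ∀ k → k < m → isOdd k ≡ true → ∀ v → entry k ~ v → v ∈ matched
    oddEntryDominated zero _ ()
    oddEntryDominated (suc k) k<m odd v e with entryNbhd (suc k) (exit~entry k) (BlockFacts.yNoTwin (block k)) e
    ... | inj₁ refl = inM k<m (oddCovered (suc k) odd rp tt)
    ... | inj₂ (inj₁ refl) = inM k<m (oddCovered (suc k) odd rq tt)
    ... | inj₂ (inj₂ refl) = inM (≤-trans (n≤1+n _) k<m) (evenCovered k (evenBeforeOdd k odd) ry)

    -- The unmatched exit of an odd block sees s, t and the entry of the next
    -- block, which is even (or block 0 when the cycle closes).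
    oddExitDominated : ∀ k → k < m → isOdd k ≡ true → ∀ v → Block.y (block k) ~ v → v ∈ matched
    oddExitDominated k k<m odd v e with exitNbhd k e
    ... | inj₁ refl = inM k<m (oddCovered k odd rs tt)
    ... | inj₂ (inj₁ refl) = inM k<m (oddCovered k odd rt tt)
    ... | inj₂ (inj₂ refl) with m≤n⇒m<n∨m≡n k<m
    ...   | inj₁ 1+k<m = inM 1+k<m (evenCovered (suc k) (cong not odd) rx)
    ...   | inj₂ refl = subst (_∈ matched) (sym entry-m) (inM (s≤s z≤n) (evenCovered 0 refl rx))

    matchedOrDominated : ∀ w → w ∈ matched ⊎ (∀ v → w ~ v → v ∈ matched)
    matchedOrDominated w with allInCycle w
    ... | k , k<m , r , refl = byRole r (isOdd k) refl
      where
      byRole : ∀ r b → isOdd k ≡ b → vertexAt (block k) r ∈ matched ⊎ (∀ v → vertexAt (block k) r ~ v → v ∈ matched)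
      byRole r false even = inj₁ (inM k<m (evenCovered k even r))
      byRole rx true odd = inj₂ (oddEntryDominated k k<m odd)
      byRole ry true odd = inj₂ (oddExitDominated k k<m odd)
      byRole rp true odd = inj₁ (inM k<m (oddCovered k odd rp tt))
      byRole rq true odd = inj₁ (inM k<m (oddCovered k odd rq tt))
      byRole rs true odd = inj₁ (inM k<m (oddCovered k odd rs tt))
      byRole rt true odd = inj₁ (inM k<m (oddCovered k odd rt tt))

    cycleBound : TwelveEdgeDomLe G (5 * n + 6)
    cycleBound = M , ((edgesBelow-adj isOdd m , uniqueBelow isOdd m ≤-refl) , maximal) , bound
      where
      maximal : ∀ u v → u ~ v → u ∈ matched ⊎ v ∈ matched
      maximal u v e with matchedOrDominated u
      ... | inj₁ h = inj₁ h
      ... | inj₂ f = inj₂ (f v e)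
      bound : 12 * length M ≤ 5 * n + 6
      bound = begin
        12 * length M                 ≡⟨ twelve≡six·double (length M) ⟩
        6 * (length M + length M)     ≤⟨ *-monoʳ-≤ 6 (alternatingLength m) ⟩
        6 * (m * 5 + 1)               ≡⟨ six·fiveBlocks m ⟩
        5 * (m * 3 + m * 3) + 6       ≤⟨ +-monoˡ-≤ 6 (*-monoʳ-≤ 5 sixBlocks≤n) ⟩
        5 * n + 6                     ∎
        where
        open ≤-Reasoning
        twelve≡six·double : ∀ L → 12 * L ≡ 6 * (L + L)
        twelve≡six·double = solve-∀
        six·fiveBlocks : ∀ m → 6 * (m * 5 + 1) ≡ 5 * (m * 3 + m * 3) + 6
        six·fiveBlocks = solve-∀

  -- Adjacent vertices have different colours, so two neighbours of one
  -- vertex are never adjacent.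
  commonNbr⇒nonAdj : ∀ {v a b} → v ~ a → v ~ b → ¬ (a ~ b)
  commonNbr⇒nonAdj va vb e = proper _ _ e (trans (colourFlips va) (sym (colourFlips vb)))

  -- K₃,₃: the perfect matching l₁r₁, l₂r₂, l₃r₃ (all of G by connectedness).
  k33Bound : Connected G → K33 → TwelveEdgeDomLe G (5 * n + 6)
  k33Bound conn K = M , ((Nbhd.va L₁ ∷ Nbhd.vb L₂ ∷ Nbhd.vc L₃ ∷ [] , unique) , maximal) ,
                    sixVertices⇒bound (endpoints M) unique refl
    where
    open K33 K
    M : List (Fin n × Fin n)
    M = (l₁ , r₁) ∷ (l₂ , r₂) ∷ (l₃ , r₃) ∷ []
    unique : Unique (endpoints M)
    unique = (adj⇒≢ (Nbhd.va L₁) ∷ Nbhd.ab R₁ ∷ adj⇒≢ (Nbhd.vb L₁) ∷ Nbhd.ac R₁ ∷ adj⇒≢ (Nbhd.vc L₁) ∷ []) ∷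
             (≢-sym (adj⇒≢ (Nbhd.va L₂)) ∷ Nbhd.ab L₁ ∷ ≢-sym (adj⇒≢ (Nbhd.va L₃)) ∷ Nbhd.ac L₁ ∷ []) ∷
             (adj⇒≢ (Nbhd.vb L₂) ∷ Nbhd.bc R₁ ∷ adj⇒≢ (Nbhd.vc L₂) ∷ []) ∷
             (≢-sym (adj⇒≢ (Nbhd.vb L₃)) ∷ Nbhd.bc L₁ ∷ []) ∷
             (adj⇒≢ (Nbhd.vc L₃) ∷ []) ∷ [] ∷ []
    Matched : Fin n → Set
    Matched w = w ∈ endpoints M
    right : ∀ {w} → OneOf3 w r₁ r₂ r₃ → Matched w
    right (inj₁ refl) = there (here refl)
    right (inj₂ (inj₁ refl)) = there (there (there (here refl)))
    right (inj₂ (inj₂ refl)) = there (there (there (there (there (here refl)))))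
    left : ∀ {w} → OneOf3 w l₁ l₂ l₃ → Matched w
    left (inj₁ refl) = here refl
    left (inj₂ (inj₁ refl)) = there (there (here refl))
    left (inj₂ (inj₂ refl)) = there (there (there (there (here refl))))
    step : ∀ {u w} → Matched u → u ~ w → Matched w
    step (here refl) e = right (Nbhd.only L₁ _ e)
    step (there (here refl)) e = left (Nbhd.only R₁ _ e)
    step (there (there (here refl))) e = right (Nbhd.only L₂ _ e)
    step (there (there (there (here refl)))) e = left (Nbhd.only R₂ _ e)
    step (there (there (there (there (here refl))))) e = right (Nbhd.only L₃ _ e)
    step (there (there (there (there (there (here refl)))))) e = left (Nbhd.only R₃ _ e)
    maximal : ∀ u v → u ~ v → Matched u ⊎ Matched v
    maximal u v e = inj₁ (spreadsEverywhere G conn Matched step (here refl) u)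

  -- Q₃: the matching aα, bγ, cβ leaves only v and z unmatched, and all
  -- their neighbours are matched.
  cubeBound : Connected G → Cube → TwelveEdgeDomLe G (5 * n + 6)
  cubeBound conn Q = M , ((Nbhd.vb Na ∷ Nbhd.vc Nb ∷ Nbhd.vb Nc ∷ [] , unique) , maximal) ,
                     sixVertices⇒bound (endpoints M) unique refl
    where
    open Cube Q
    M : List (Fin n × Fin n)
    M = (a , α) ∷ (b , γ) ∷ (c , β) ∷ []
    va = Nbhd.va Nv
    vb = Nbhd.vb Nv
    vc = Nbhd.vc Nv
    unique : Unique (endpoints M)
    unique = (adj⇒≢ (Nbhd.vb Na) ∷ Nbhd.ab Nv ∷ (λ e → commonNbr⇒nonAdj va vb (sym~ (subst (b ~_) (sym e) (Nbhd.vc Nb))))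
               ∷ Nbhd.ac Nv ∷ adj⇒≢ (Nbhd.vc Na) ∷ []) ∷
             (≢-sym (adj⇒≢ (Nbhd.vb Nb)) ∷ Nbhd.bc Nb ∷ (λ e → commonNbr⇒nonAdj va vc (subst (a ~_) e (Nbhd.vb Na)))
               ∷ Nbhd.bc Na ∷ []) ∷
             (adj⇒≢ (Nbhd.vc Nb) ∷ Nbhd.bc Nv ∷ (λ e → commonNbr⇒nonAdj va vb (subst (a ~_) (sym e) (Nbhd.vc Na))) ∷ []) ∷
             (≢-sym (adj⇒≢ (Nbhd.vc Nc)) ∷ ≢-sym (Nbhd.bc Nc) ∷ []) ∷
             (adj⇒≢ (Nbhd.vb Nc) ∷ []) ∷ [] ∷ []
    E : List (Fin n)
    E = endpoints M
    a∈ : a ∈ E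
    a∈ = here refl
    α∈ : α ∈ E
    α∈ = there (here refl)
    b∈ : b ∈ E
    b∈ = there (there (here refl))
    γ∈ : γ ∈ E
    γ∈ = there (there (there (here refl)))
    c∈ : c ∈ E
    c∈ = there (there (there (there (here refl))))
    β∈ : β ∈ E
    β∈ = there (there (there (there (there (here refl)))))
    all∈ : ∀ {w x₁ x₂ x₃} → x₁ ∈ E → x₂ ∈ E → x₃ ∈ E → OneOf3 w x₁ x₂ x₃ → w ∈ E
    all∈ h₁ h₂ h₃ (inj₁ refl) = h₁
    all∈ h₁ h₂ h₃ (inj₂ (inj₁ refl)) = h₂
    all∈ h₁ h₂ h₃ (inj₂ (inj₂ refl)) = h₃
    -- the vertex set is {v, z} ∪ E
    Known : Fin n → Set
    Known w = w ≡ v ⊎ w ≡ z ⊎ w ∈ E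
    all-known : ∀ {w x₁ x₂ x₃} → Known x₁ → Known x₂ → Known x₃ → OneOf3 w x₁ x₂ x₃ → Known w
    all-known h₁ h₂ h₃ (inj₁ refl) = h₁
    all-known h₁ h₂ h₃ (inj₂ (inj₁ refl)) = h₂
    all-known h₁ h₂ h₃ (inj₂ (inj₂ refl)) = h₃
    v-known : Known v
    v-known = inj₁ refl
    z-known : Known z
    z-known = inj₂ (inj₁ refl)
    E-known : ∀ {w} → w ∈ E → Known w
    E-known h = inj₂ (inj₂ h)
    step : ∀ {u w} → Known u → u ~ w → Known w
    step (inj₁ refl) e = E-known (all∈ a∈ b∈ c∈ (Nbhd.only Nv _ e))
    step (inj₂ (inj₁ refl)) e = E-known (all∈ α∈ β∈ γ∈ (Nbhd.only Nz _ e))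
    step (inj₂ (inj₂ (here refl))) e = all-known v-known (E-known α∈) (E-known β∈) (Nbhd.only Na _ e)
    step (inj₂ (inj₂ (there (here refl)))) e = all-known (E-known a∈) (E-known b∈) z-known (Nbhd.only Nα _ e)
    step (inj₂ (inj₂ (there (there (here refl))))) e = all-known v-known (E-known α∈) (E-known γ∈) (Nbhd.only Nb _ e)
    step (inj₂ (inj₂ (there (there (there (here refl)))))) e = all-known (E-known b∈) (E-known c∈) z-known (Nbhd.only Nγ _ e)
    step (inj₂ (inj₂ (there (there (there (there (here refl))))))) e = all-known v-known (E-known β∈) (E-known γ∈) (Nbhd.only Nc _ e)
    step (inj₂ (inj₂ (there (there (there (there (there (here refl)))))))) e = all-known (E-known a∈) (E-known c∈) z-known (Nbhd.only Nβ _ e)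
    maximal : ∀ u w → u ~ w → u ∈ E ⊎ w ∈ E
    maximal u w e with spreadsEverywhere G conn Known step v-known u
    ... | inj₁ refl = inj₂ (all∈ a∈ b∈ c∈ (Nbhd.only Nv _ e))
    ... | inj₂ (inj₁ refl) = inj₂ (all∈ α∈ β∈ γ∈ (Nbhd.only Nz _ e))
    ... | inj₂ (inj₂ h) = inj₁ h

theorem2 : (n : ℕ) (G : Graph n) → Connected G → Cubic G → Bipartite G → TStarFree G → TwelveEdgeDomLe G (5 * n + 6)
theorem2 zero G conn cubic bip tfree = [] , (([] , []) , λ ()) , z≤n
theorem2 (suc n) G conn cubic (col , proper) tfree = fromTwinsOrCube (twinsOrCube zero)
  where
  open LocalStructure G cubic col proper tfree
  fromK33OrBlock : K33 ⊎ Block → TwelveEdgeDomLe G (5 * suc n + 6)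
  fromK33OrBlock (inj₁ K) = k33Bound conn K
  fromK33OrBlock (inj₂ B) = BlockCycle.cycleBound conn B
  fromTwinsOrCube : TwinPair ⊎ Cube → TwelveEdgeDomLe G (5 * suc n + 6)
  fromTwinsOrCube (inj₁ T) = fromK33OrBlock (twinsGiveK33OrBlock T)
  fromTwinsOrCube (inj₂ Q) = cubeBound conn Q
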